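{- For all positive integers $r,s,k$ with $1\le r,s\le k$, $$\sum_{n\ge0}\big|\mathcal A_{2n+1}^{(k)}(r\to s)\big|\,x^{2n}=\begin{cases}(-1)^{r+s+1}\dfrac{x\,U_{2r-2}(x/2)\,U_{2k+1-2s}(x/2)}{U_{2k}(x/2)},&\text{if } r<s,\\[2mm] 1-\dfrac{x\,U_{2r-2}(x/2)\,U_{2k+1-2r}(x/2)}{U_{2k}(x/2)},&\text{if } r=s,\\[2mm] (-1)^{r+s+1}\dfrac{x\,U_{2s-2}(x/2)\,U_{2k+1-2r}(x/2)}{U_{2k}(x/2)},&\text{if } r>s,\end{cases}$$ and $$\sum_{n\ge0}\big|\mathcal A_{2n+2}^{(k)}(r\to s)\big|\,x^{2n+1}=\begin{cases}(-1)^{r+s+1}\dfrac{x\,U_{2r-2}(x/2)\,U_{2k-2s}(x/2)}{U_{2k}(x/2)},&\text{if } r\le s,\\[2mm] (-1)^{r+s+1}\dfrac{x\,U_{2s-1}(x/2)\,U_{2k-2r+1}(x/2)}{U_{2k}(x/2)},&\text{if } r>s.\end{cases}$$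
   Context: $U_n(x)$ denotes the $n$-th Chebyshev polynomial of the second kind, $U_n(\cos\theta)=\sin((n+1)\theta)/\sin\theta$; equivalently $U_0=1$, $U_1(x)=2x$, $U_{n+1}(x)=2xU_n(x)-U_{n-1}(x)$. For positive integers $n,k$ and $1\le r,s\le k$, $\mathcal A_n^{(k)}(r\to s)$ denotes the set of sequences of integers $(a_1,\dots,a_n)$ with $1\le a_i\le k$ for all $i$, $a_1=r$, $a_n=s$, which are alternating in the sense $a_1\le a_2\ge a_3\le a_4\ge\cdots$ (i.e. $a_{2i-1}\le a_{2i}$ and $a_{2i}\ge a_{2i+1}$ whenever the indices are in range). -}

module Defs where

open import Data.Nat using (ℕ; zero; suc; _≤_; _≥_; _∸_)
import Data.Nat as ℕ
open import Data.Integer using (ℤ; +_; -_; _-_; _^_) renaming (_+_ to _+ℤ_; _*_ to _*ℤ_)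
open import Data.List using (List; []; _∷_; head; last)
open import Data.Vec using (Vec; toList)
open import Data.Vec.Relation.Unary.All using (All)
open import Data.Maybe using (just)
open import Data.Product using (Σ; _×_)
open import Data.Unit using (⊤)
open import Relation.Binary.PropositionalEquality using (_≡_)

mutual
  AltUp : List ℕ → Set
  AltUp (a ∷ b ∷ rest) = (a ≤ b) × AltDown (b ∷ rest)
  AltUp _              = ⊤

  AltDown : List ℕ → Set
  AltDown (a ∷ b ∷ rest) = (a ≥ b) × AltUp (b ∷ rest)
  AltDown _              = ⊤

𝒜 : ℕ → ℕ → ℕ → ℕ → Set
𝒜 n k r s =
  Σ (Vec ℕ n) λ v →
    All (λ a → (1 ≤ a) × (a ≤ k)) v
    × (head (toList v) ≡ just r)
    × (last (toList v) ≡ just s)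
    × AltUp (toList v)

Series : Set
Series = ℕ → ℤ

sumBelow : ℕ → (ℕ → ℤ) → ℤ
sumBelow zero    f = + 0
sumBelow (suc n) f = sumBelow n f +ℤ f n

_⊛_ : Series → Series → Series
(f ⊛ g) m = sumBelow (suc m) (λ i → f i *ℤ g (m ∸ i))

_⊕_ : Series → Series → Series
(f ⊕ g) m = f m +ℤ g m

_⊖_ : Series → Series → Series
(f ⊖ g) m = f m - g m

_·_ : ℤ → Series → Series
(c · f) m = c *ℤ f m

X* : Series → Series
X* f zero    = + 0
X* f (suc m) = f m

one : Series
one zero    = + 1
one (suc _) = + 0

-- Uhalf n = U_n(x/2), as a polynomial in x (coefficient sequence).
-- From U₀ = 1, U₁(y) = 2y, U_{n+1}(y) = 2y Uₙ(y) − U_{n−1}(y) with y = x/2: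
-- U₀(x/2) = 1, U₁(x/2) = x, U_{n+1}(x/2) = x·Uₙ(x/2) − U_{n−1}(x/2).

Uhalf : ℕ → Series
Uhalf zero          = one
Uhalf (suc zero)    = X* one
Uhalf (suc (suc n)) = X* (Uhalf (suc n)) ⊖ Uhalf n

-- Σ_{n≥0} a(2n+1) x^{2n}
gfOdd : (ℕ → ℕ) → Series
gfOdd a zero          = + a 1
gfOdd a (suc zero)    = + 0
gfOdd a (suc (suc m)) = gfOdd (λ n → a (suc (suc n))) m

-- Σ_{n≥0} a(2n+2) x^{2n+1}
gfEven : (ℕ → ℕ) → Series
gfEven a = X* (gfOdd (λ n → a (suc n)))

sgn : ℕ → ℤ
sgn e = (- (+ 1)) ^ e

_≋_ : Series → Series → Set
f ≋ g = ∀ m → f m ≡ g m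

module Submission where

-- Let A_r and B_r be the generating functions, over all lengths, of the alternating sequences
-- from r to s whose first step goes up, resp. down. Removing the first entry shows that they
-- satisfy the linear system A_r = [r = s] + x Σ_{b ≥ r} B_b, B_r = [r = s] + x Σ_{b ≤ r} A_b,
-- whose solution is unique (compare coefficients degree by degree). So it suffices to check
-- that the claimed numerators, with odd and even lengths added, solve the system multiplied
-- by U_{2k}(x/2). Taking differences in r, this reduces to ring identities between Chebyshev
-- polynomials, via U_{n+2} = x U_{n+1} − U_n and U_{a+b+2} = U_{a+1} U_{b+1} − U_a U_b.
-- As U_{2k}(x/2) is even, the two series of the theorem are the even and odd parts of
-- U_{2k}(x/2) A_r.

open import Defs
open import Level using (0ℓ)
open import Function using (_∘_)
open import Function.Bundles using (_↔_; mk↔ₛ′)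
open import Function.Properties.Inverse using (↔-sym; ↔-trans)
open import Data.Empty using (⊥-elim)
open import Data.Unit using (tt)
open import Data.Bool using (Bool; true; false; not; _xor_)
open import Data.Bool.Properties using (not-involutive)
open import Data.Nat as ℕ using (ℕ; zero; suc; _+_; _*_; _≤_; _<_; _∸_; z≤n; s≤s)
import Data.Nat.Properties as ℕ
open import Data.Integer as ℤ using (ℤ; +_; -_) renaming (_+_ to _+ℤ_; _*_ to _*ℤ_)
import Data.Integer.Properties as ℤ
open import Data.Integer.Tactic.RingSolver using (solve-∀)
open import Data.Fin as Fin using (Fin)
import Data.Fin.Properties as Fin
open import Data.Fin.Permutation using (↔⇒≡)
open import Data.Maybe using (Maybe; just; nothing)
open import Data.Maybe.Properties using (just-injective)
open import Data.List using (List; []; _∷_; head; last)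
open import Data.Vec using (Vec; []; _∷_; toList)
open import Data.Vec.Relation.Unary.All using (All; []; _∷_)
open import Data.Product using (Σ; _×_; _,_; proj₁; proj₂)
open import Data.Sum using (_⊎_; inj₁; inj₂)
open import Data.Sum.Function.Propositional using (_⊎-↔_)
open import Algebra.Bundles using (CommutativeRing)
open import Algebra.Solver.Ring.AlmostCommutativeRing
  using (AlmostCommutativeRing; fromCommutativeRing; _-Raw-AlmostCommutative⟶_)
open import Relation.Nullary using (¬_; yes; no)
open import Relation.Binary.Definitions using (tri<; tri≈; tri>)
open import Relation.Binary.PropositionalEquality using (_≡_; refl; sym; trans; cong; cong₂; subst)
open import Relation.Binary.PropositionalEquality.WithK using (≡-irrelevant)

-- Formal power series over ℤ

infixl 6 _+ˢ_
infixl 7 _*ˢ_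
infix  8 -ˢ_

_+ˢ_ : Series → Series → Series
_+ˢ_ = _⊕_

-ˢ_ : Series → Series
(-ˢ f) m = - f m

0ˢ : Series
0ˢ _ = + 0

tail : Series → Series
tail f m = f (suc m)

-- The Cauchy product by recursion on the degree, which makes the ring laws provable by induction.
_*ˢ_ : Series → Series → Series
(f *ˢ g) zero    = f 0 *ℤ g 0
(f *ˢ g) (suc m) = f 0 *ℤ g (suc m) +ℤ (tail f *ˢ g) m

sumBelow-suc : ∀ n h → sumBelow (suc n) h ≡ h 0 +ℤ sumBelow n (λ i → h (suc i))
sumBelow-suc zero    h = trans (ℤ.+-identityˡ (h 0)) (sym (ℤ.+-identityʳ (h 0)))
sumBelow-suc (suc n) h = trans (cong (_+ℤ h (suc n)) (sumBelow-suc n h)) (ℤ.+-assoc (h 0) _ _)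

⊛≋*ˢ : ∀ f g → (f ⊛ g) ≋ (f *ˢ g)
⊛≋*ˢ f g zero    = ℤ.+-identityˡ _
⊛≋*ˢ f g (suc m) = trans (sumBelow-suc (suc m) (λ i → f i *ℤ g (suc m ∸ i)))
                         (cong (f 0 *ℤ g (suc m) +ℤ_) (⊛≋*ˢ (tail f) g m))

≋-refl : ∀ {f} → f ≋ f
≋-refl _ = refl

≋-sym : ∀ {f g} → f ≋ g → g ≋ f
≋-sym p m = sym (p m)

≋-trans : ∀ {f g h} → f ≋ g → g ≋ h → f ≋ h
≋-trans p q m = trans (p m) (q m)

*ˢ-cong : ∀ {f f′ g g′} → f ≋ f′ → g ≋ g′ → (f *ˢ g) ≋ (f′ *ˢ g′)
*ˢ-cong p q zero    = cong₂ _*ℤ_ (p 0) (q 0)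
*ˢ-cong p q (suc m) = cong₂ _+ℤ_ (cong₂ _*ℤ_ (p 0) (q (suc m))) (*ˢ-cong (λ n → p (suc n)) q m)

*ˢ-distribʳ-+ˢ : ∀ f g h → ((f +ˢ g) *ˢ h) ≋ (f *ˢ h +ˢ g *ˢ h)
*ˢ-distribʳ-+ˢ f g h zero    = ℤ.*-distribʳ-+ (h 0) (f 0) (g 0)
*ˢ-distribʳ-+ˢ f g h (suc m) =
  trans (cong₂ _+ℤ_ (ℤ.*-distribʳ-+ (h (suc m)) (f 0) (g 0)) (*ˢ-distribʳ-+ˢ (tail f) (tail g) h m))
        (interchange (f 0 *ℤ h (suc m)) (g 0 *ℤ h (suc m)) _ _)
  where
  interchange : ∀ a b c d → (a +ℤ b) +ℤ (c +ℤ d) ≡ (a +ℤ c) +ℤ (b +ℤ d)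
  interchange = solve-∀

·-*ˢ-assoc : ∀ c f g → ((c · f) *ˢ g) ≋ (c · (f *ˢ g))
·-*ˢ-assoc c f g zero    = ℤ.*-assoc c (f 0) (g 0)
·-*ˢ-assoc c f g (suc m) =
  trans (cong₂ _+ℤ_ (ℤ.*-assoc c (f 0) (g (suc m))) (·-*ˢ-assoc c (tail f) g m))
        (sym (ℤ.*-distribˡ-+ c _ _))

*ˢ-sucʳ : ∀ f g m → (f *ˢ g) (suc m) ≡ f (suc m) *ℤ g 0 +ℤ (f *ˢ tail g) m
*ˢ-sucʳ f g zero    = ℤ.+-comm (f 0 *ℤ g 1) (f 1 *ℤ g 0)
*ˢ-sucʳ f g (suc m) =
  trans (cong (f 0 *ℤ g (suc (suc m)) +ℤ_) (*ˢ-sucʳ (tail f) g m))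
        (swap (f 0 *ℤ g (suc (suc m))) (f (suc (suc m)) *ℤ g 0) ((tail f *ˢ tail g) m))
  where
  swap : ∀ a b c → a +ℤ (b +ℤ c) ≡ b +ℤ (a +ℤ c)
  swap = solve-∀

*ˢ-comm : ∀ f g → (f *ˢ g) ≋ (g *ˢ f)
*ˢ-comm f g zero    = ℤ.*-comm (f 0) (g 0)
*ˢ-comm f g (suc m) =
  trans (cong₂ _+ℤ_ (ℤ.*-comm (f 0) (g (suc m))) (*ˢ-comm (tail f) g m)) (sym (*ˢ-sucʳ g f m))

*ˢ-assoc : ∀ f g h → ((f *ˢ g) *ˢ h) ≋ (f *ˢ (g *ˢ h))
*ˢ-assoc f g h zero    = ℤ.*-assoc (f 0) (g 0) (h 0)
*ˢ-assoc f g h (suc m) =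
  trans (cong ((f 0 *ℤ g 0) *ℤ h (suc m) +ℤ_)
          (trans (*ˢ-distribʳ-+ˢ (f 0 · tail g) (tail f *ˢ g) h m)
                 (cong₂ _+ℤ_ (·-*ˢ-assoc (f 0) (tail g) h m) (*ˢ-assoc (tail f) g h m))))
        (regroup (f 0) (g 0) (h (suc m)) ((tail g *ˢ h) m) ((tail f *ˢ (g *ˢ h)) m))
  where
  regroup : ∀ a b c d e → (a *ℤ b) *ℤ c +ℤ (a *ℤ d +ℤ e) ≡ a *ℤ (b *ℤ c +ℤ d) +ℤ e
  regroup = solve-∀

*ˢ-zeroˡ : ∀ g → (0ˢ *ˢ g) ≋ 0ˢ
*ˢ-zeroˡ g zero    = refl
*ˢ-zeroˡ g (suc m) = cong (+ 0 +ℤ_) (*ˢ-zeroˡ g m)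

*ˢ-identityˡ : ∀ g → (one *ˢ g) ≋ g
*ˢ-identityˡ g zero    = ℤ.*-identityˡ (g 0)
*ˢ-identityˡ g (suc m) =
  trans (cong₂ _+ℤ_ (ℤ.*-identityˡ (g (suc m))) (*ˢ-zeroˡ g m)) (ℤ.+-identityʳ _)

X*-*ˢ : ∀ f g → (X* f *ˢ g) ≋ X* (f *ˢ g)
X*-*ˢ f g zero    = refl
X*-*ˢ f g (suc m) = ℤ.+-identityˡ _

-- A record rather than _≋_ itself, so that unification cannot unfold it and implicit
-- arguments of the congruence lemmas stay inferable.
infix 4 _≈ˢ_
record _≈ˢ_ (f g : Series) : Set where
  constructor coeffwise
  field coeff : f ≋ g
open _≈ˢ_ public

≈ˢ-refl : ∀ {f} → f ≈ˢ f
≈ˢ-refl = coeffwise ≋-refl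

≈ˢ-sym : ∀ {f g} → f ≈ˢ g → g ≈ˢ f
≈ˢ-sym (coeffwise p) = coeffwise (≋-sym p)

≈ˢ-trans : ∀ {f g h} → f ≈ˢ g → g ≈ˢ h → f ≈ˢ h
≈ˢ-trans (coeffwise p) (coeffwise q) = coeffwise (≋-trans p q)

seriesRing : CommutativeRing 0ℓ 0ℓ
seriesRing = record
  { Carrier = Series ; _≈_ = _≈ˢ_ ; _+_ = _+ˢ_ ; _*_ = _*ˢ_ ; -_ = -ˢ_ ; 0# = 0ˢ ; 1# = one
  ; isCommutativeRing = record
    { isRing = record
      { +-isAbelianGroup = record
        { isGroup = record
          { isMonoid = record
            { isSemigroup = record
              { isMagma = record
                { isEquivalence = record { refl = ≈ˢ-refl ; sym = ≈ˢ-sym ; trans = ≈ˢ-trans }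
                ; ∙-cong = λ (coeffwise p) (coeffwise q) → coeffwise λ m → cong₂ _+ℤ_ (p m) (q m) }
              ; assoc = λ f g h → coeffwise λ m → ℤ.+-assoc (f m) (g m) (h m) }
            ; identity = (λ f → coeffwise λ m → ℤ.+-identityˡ (f m))
                       , (λ f → coeffwise λ m → ℤ.+-identityʳ (f m)) }
          ; inverse = (λ f → coeffwise λ m → ℤ.+-inverseˡ (f m))
                    , (λ f → coeffwise λ m → ℤ.+-inverseʳ (f m))
          ; ⁻¹-cong = λ (coeffwise p) → coeffwise λ m → cong -_ (p m) }
        ; comm = λ f g → coeffwise λ m → ℤ.+-comm (f m) (g m) }
      ; *-cong = λ (coeffwise p) (coeffwise q) → coeffwise (*ˢ-cong p q)
      ; *-assoc = λ f g h → coeffwise (*ˢ-assoc f g h)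
      ; *-identity = (λ f → coeffwise (*ˢ-identityˡ f))
                   , (λ f → coeffwise (≋-trans (*ˢ-comm f one) (*ˢ-identityˡ f)))
      ; distrib = (λ f g h → coeffwise (≋-trans (*ˢ-comm f (g +ˢ h)) (≋-trans (*ˢ-distribʳ-+ˢ g h f)
                                λ m → cong₂ _+ℤ_ (*ˢ-comm g f m) (*ˢ-comm h f m))))
                , (λ h f g → coeffwise (*ˢ-distribʳ-+ˢ f g h)) }
    ; *-comm = λ f g → coeffwise (*ˢ-comm f g) } }

open CommutativeRing seriesRing public
  using (+-cong; *-cong; -‿cong; +-comm; +-assoc; *-assoc; +-identityˡ; +-identityʳ; *-identityˡ;
         zeroˡ; distribʳ)
  renaming (setoid to seriesSetoid; reflexive to ≈ˢ-reflexive)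

+ˢ-congˡ : ∀ f {g g′} → g ≈ˢ g′ → f +ˢ g ≈ˢ f +ˢ g′
+ˢ-congˡ f p = +-cong (≈ˢ-refl {f}) p

+ˢ-congʳ : ∀ {f f′} g → f ≈ˢ f′ → f +ˢ g ≈ˢ f′ +ˢ g
+ˢ-congʳ g p = +-cong p (≈ˢ-refl {g})

*ˢ-congˡ : ∀ f {g g′} → g ≈ˢ g′ → f *ˢ g ≈ˢ f *ˢ g′
*ˢ-congˡ f p = *-cong (≈ˢ-refl {f}) p

*ˢ-congʳ : ∀ {f f′} g → f ≈ˢ f′ → f *ˢ g ≈ˢ f′ *ˢ g
*ˢ-congʳ g p = *-cong p (≈ˢ-refl {g})

const : ℤ → Series
const c zero    = c
const c (suc _) = + 0

const-* : ∀ a b → const (a *ℤ b) ≈ˢ const a *ˢ const b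
const-* a b = coeffwise λ
  { zero    → refl
  ; (suc m) →
  sym (trans (cong (_+ℤ (tail (const a) *ˢ const b) m) (ℤ.*-zeroʳ a))
             (trans (ℤ.+-identityˡ _) (*ˢ-zeroˡ (const b) m))) }

const-hom : ℤ.+-*-rawRing -Raw-AlmostCommutative⟶ fromCommutativeRing seriesRing
const-hom = record
  { ⟦_⟧    = const
  ; +-homo = λ a b → coeffwise λ { zero → refl ; (suc m) → refl }
  ; *-homo = const-*
  ; -‿homo = λ a → coeffwise λ { zero → refl ; (suc m) → refl }
  ; 0-homo = coeffwise λ { zero → refl ; (suc m) → refl }
  ; 1-homo = coeffwise λ { zero → refl ; (suc m) → refl } }

const-≟ : ∀ a b → Maybe (const a ≈ˢ const b)
const-≟ a b with a ℤ.≟ b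
... | yes refl = just ≈ˢ-refl
... | no _     = nothing

open import Algebra.Solver.Ring ℤ.+-*-rawRing (fromCommutativeRing seriesRing) const-hom const-≟
  using (solve; _:=_; _:+_; _:*_; _:-_; :-_; con)
open import Relation.Binary.Reasoning.Setoid seriesSetoid

const-0 : const (+ 0) ≈ˢ 0ˢ
const-0 = coeffwise λ { zero → refl ; (suc m) → refl }

const0-*ˢ : ∀ f → const (+ 0) *ˢ f ≈ˢ const (+ 0)
const0-*ˢ f = ≈ˢ-trans (*ˢ-congʳ f const-0) (≈ˢ-trans (zeroˡ f) (≈ˢ-sym const-0))

X : Series
X = X* one

X*≈X*ˢ : ∀ f → X* f ≈ˢ X *ˢ f
X*≈X*ˢ f = coeffwise (≋-sym (≋-trans (X*-*ˢ one f) λ { zero → refl ; (suc m) → *ˢ-identityˡ f m }))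

const-1 : const (+ 1) ≈ˢ one
const-1 = coeffwise λ { zero → refl ; (suc m) → refl }

const-*ˢ : ∀ c h → const c *ˢ h ≈ˢ c · h
const-*ˢ c h = coeffwise λ
  { zero    → refl
  ; (suc m) → trans (cong (c *ℤ h (suc m) +ℤ_) (*ˢ-zeroˡ h m)) (ℤ.+-identityʳ _) }

X*⊛≈ : ∀ f g → X* (f ⊛ g) ≈ˢ X *ˢ (f *ˢ g)
X*⊛≈ f g = ≈ˢ-trans (coeffwise λ { zero → refl ; (suc m) → ⊛≋*ˢ f g m }) (X*≈X*ˢ (f *ˢ g))

·X*⊛≈ : ∀ {c c′ f f′ g g′} → c ≡ c′ → f ≡ f′ → g ≡ g′ →
  c · X* (f ⊛ g) ≈ˢ const c′ *ˢ X *ˢ (f′ *ˢ g′)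
·X*⊛≈ {c} {f = f} {g = g} refl refl refl = begin
  c · X* (f ⊛ g)             ≈⟨ coeffwise (λ m → cong (c *ℤ_) (coeff (X*⊛≈ f g) m)) ⟩
  c · (X *ˢ (f *ˢ g))        ≈⟨ ≈ˢ-sym (const-*ˢ c _) ⟩
  const c *ˢ (X *ˢ (f *ˢ g)) ≈⟨ ≈ˢ-sym (*-assoc (const c) X _) ⟩
  const c *ˢ X *ˢ (f *ˢ g)   ∎

-- The Chebyshev polynomials U_n(x/2)

Uhalf-rec : ∀ n → Uhalf (suc (suc n)) ≈ˢ X *ˢ Uhalf (suc n) +ˢ -ˢ Uhalf n
Uhalf-rec n = coeffwise λ m → cong (_+ℤ - Uhalf n m) (coeff (X*≈X*ˢ (Uhalf (suc n))) m)

Uhalf-+ : ∀ a b → Uhalf (suc a + suc b) ≈ˢ Uhalf (suc a) *ˢ Uhalf (suc b) +ˢ -ˢ (Uhalf a *ˢ Uhalf b)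
Uhalf-+ a zero = begin
  Uhalf (suc a + 1)                  ≡⟨ cong Uhalf (ℕ.+-comm (suc a) 1) ⟩
  Uhalf (suc (suc a))                ≈⟨ Uhalf-rec a ⟩
  X *ˢ Uhalf (suc a) +ˢ -ˢ Uhalf a
    ≈⟨ solve 3 (λ x u v → x :* u :- v := u :* x :- v :* con (+ 1)) ≈ˢ-refl X (Uhalf (suc a)) (Uhalf a) ⟩
  Uhalf (suc a) *ˢ X +ˢ -ˢ (Uhalf a *ˢ const (+ 1))
    ≈⟨ +ˢ-congˡ (Uhalf (suc a) *ˢ X) (-‿cong (*ˢ-congˡ (Uhalf a) const-1)) ⟩
  Uhalf (suc a) *ˢ X +ˢ -ˢ (Uhalf a *ˢ one) ∎
Uhalf-+ a (suc zero) = begin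
  Uhalf (suc a + 2)                  ≡⟨ cong Uhalf (ℕ.+-comm (suc a) 2) ⟩
  Uhalf (suc (suc (suc a)))
    ≈⟨ ≈ˢ-trans (Uhalf-rec (suc a)) (+ˢ-congʳ (-ˢ Uhalf (suc a)) (*ˢ-congˡ X (Uhalf-rec a))) ⟩
  X *ˢ (X *ˢ Uhalf (suc a) +ˢ -ˢ Uhalf a) +ˢ -ˢ Uhalf (suc a)
    ≈⟨ solve 3 (λ x u v → x :* (x :* u :- v) :- u := u :* (x :* x :- con (+ 1)) :- v :* x) ≈ˢ-refl
         X (Uhalf (suc a)) (Uhalf a) ⟩
  Uhalf (suc a) *ˢ (X *ˢ X +ˢ -ˢ const (+ 1)) +ˢ -ˢ (Uhalf a *ˢ X)
    ≈⟨ +ˢ-congʳ (-ˢ (Uhalf a *ˢ X)) (*ˢ-congˡ (Uhalf (suc a)) (+ˢ-congˡ (X *ˢ X) (-‿cong const-1))) ⟩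
  Uhalf (suc a) *ˢ (X *ˢ X +ˢ -ˢ one) +ˢ -ˢ (Uhalf a *ˢ X)
    ≈⟨ +ˢ-congʳ (-ˢ (Uhalf a *ˢ X)) (*ˢ-congˡ (Uhalf (suc a)) (≈ˢ-sym (Uhalf-rec 0))) ⟩
  Uhalf (suc a) *ˢ Uhalf 2 +ˢ -ˢ (Uhalf a *ˢ X) ∎
Uhalf-+ a (suc (suc b)) = begin
  Uhalf (suc a + suc (suc (suc b)))         ≡⟨ cong Uhalf (ℕ.+-suc (suc a) (suc (suc b))) ⟩
  Uhalf (suc (suc a + suc (suc b)))         ≡⟨ cong (Uhalf ∘ suc) (ℕ.+-suc (suc a) (suc b)) ⟩
  Uhalf (suc (suc (suc a + suc b)))         ≈⟨ Uhalf-rec (suc a + suc b) ⟩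
  X *ˢ Uhalf (suc (suc a + suc b)) +ˢ -ˢ Uhalf (suc a + suc b)
    ≡⟨ cong (λ n → X *ˢ Uhalf n +ˢ -ˢ Uhalf (suc a + suc b)) (sym (ℕ.+-suc (suc a) (suc b))) ⟩
  X *ˢ Uhalf (suc a + suc (suc b)) +ˢ -ˢ Uhalf (suc a + suc b)
    ≈⟨ +-cong (*ˢ-congˡ X (Uhalf-+ a (suc b))) (-‿cong (Uhalf-+ a b)) ⟩
  X *ˢ (p *ˢ u +ˢ -ˢ (q *ˢ v)) +ˢ -ˢ (p *ˢ v +ˢ -ˢ (q *ˢ w))
    ≈⟨ solve 6 (λ x p q u v w → x :* (p :* u :- q :* v) :- (p :* v :- q :* w)
                              := p :* (x :* u :- v) :- q :* (x :* v :- w)) ≈ˢ-refl X p q u v w ⟩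
  p *ˢ (X *ˢ u +ˢ -ˢ v) +ˢ -ˢ (q *ˢ (X *ˢ v +ˢ -ˢ w))
    ≈⟨ +-cong (*ˢ-congˡ p (≈ˢ-sym (Uhalf-rec (suc b)))) (-‿cong (*ˢ-congˡ q (≈ˢ-sym (Uhalf-rec b)))) ⟩
  p *ˢ Uhalf (suc (suc (suc b))) +ˢ -ˢ (q *ˢ Uhalf (suc (suc b))) ∎
  where
  p = Uhalf (suc a)
  q = Uhalf a
  u = Uhalf (suc (suc b))
  v = Uhalf (suc b)
  w = Uhalf b

double : ℕ → ℕ
double zero    = zero
double (suc n) = suc (suc (double n))

double-+ : ∀ a b → double (a + b) ≡ double a + double b
double-+ zero    b = refl
double-+ (suc a) b = cong (λ n → suc (suc n)) (double-+ a b)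

Ueven Uodd : ℕ → Series
Ueven n = Uhalf (double n)
Uodd  n = Uhalf (suc (double n))

Ueven-suc : ∀ n → Ueven (suc n) ≈ˢ X *ˢ Uodd n +ˢ -ˢ Ueven n
Ueven-suc n = Uhalf-rec (double n)

Uodd-suc : ∀ n → Uodd (suc n) ≈ˢ X *ˢ Ueven (suc n) +ˢ -ˢ Uodd n
Uodd-suc n = Uhalf-rec (suc (double n))

Ueven-+ : ∀ j t → Ueven (suc (j + t)) ≈ˢ Uodd j *ˢ Uodd t +ˢ -ˢ (Ueven j *ˢ Ueven t)
Ueven-+ j t = begin
  Uhalf (double (suc (j + t)))               ≡⟨ cong Uhalf index ⟩
  Uhalf (suc (double j) + suc (double t))    ≈⟨ Uhalf-+ (double j) (double t) ⟩
  Uodd j *ˢ Uodd t +ˢ -ˢ (Ueven j *ˢ Ueven t) ∎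
  where
  index : double (suc (j + t)) ≡ suc (double j) + suc (double t)
  index = cong suc (trans (cong suc (double-+ j t)) (sym (ℕ.+-suc (double j) (double t))))

-- The transfer system

sumFrom : ℕ → ℕ → (ℕ → Series) → Series
sumFrom i zero    Z = 0ˢ
sumFrom i (suc l) Z = Z i +ˢ sumFrom (suc i) l Z

sumFrom-snoc : ∀ i l Z → sumFrom i (suc l) Z ≈ˢ sumFrom i l Z +ˢ Z (i + l)
sumFrom-snoc i zero    Z = ≈ˢ-trans (+-identityʳ (Z i))
  (≈ˢ-trans (≈ˢ-sym (+-identityˡ (Z i))) (+ˢ-congˡ 0ˢ (≈ˢ-reflexive (cong Z (sym (ℕ.+-identityʳ i))))))
sumFrom-snoc i (suc l) Z = begin
  Z i +ˢ sumFrom (suc i) (suc l) Z              ≈⟨ +ˢ-congˡ (Z i) (sumFrom-snoc (suc i) l Z) ⟩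
  Z i +ˢ (sumFrom (suc i) l Z +ˢ Z (suc i + l))  ≈⟨ ≈ˢ-sym (+-assoc (Z i) _ _) ⟩
  Z i +ˢ sumFrom (suc i) l Z +ˢ Z (suc i + l)
    ≡⟨ cong (λ n → Z i +ˢ sumFrom (suc i) l Z +ˢ Z n) (sym (ℕ.+-suc i l)) ⟩
  Z i +ˢ sumFrom (suc i) l Z +ˢ Z (i + suc l)    ∎

-- Removing the first entry of an alternating sequence from i: Y i and Z i stand for the
-- generating functions of those whose first step goes up, resp. down, and F i for the
-- sequences of length one.
record IsTransferSolution (K : ℕ) (F Y Z : ℕ → Series) : Set where
  field
    up   : ∀ i → i ≤ K → Y i ≈ˢ F i +ˢ X *ˢ sumFrom i (suc K ∸ i) Z
    down : ∀ i → i ≤ K → Z i ≈ˢ F i +ˢ X *ˢ sumFrom 0 (suc i) Y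

telescope-up : ∀ K (F Y Z : ℕ → Series) →
  (∀ i → i < K → Y i ≈ˢ Y (suc i) +ˢ -ˢ F (suc i) +ˢ F i +ˢ X *ˢ Z i) →
  Y K ≈ˢ F K +ˢ X *ˢ Z K →
  ∀ i → i ≤ K → Y i ≈ˢ F i +ˢ X *ˢ sumFrom i (suc K ∸ i) Z
telescope-up K F Y Z step last i i≤K
  rewrite ℕ.+-∸-assoc 1 i≤K = go (K ∸ i) i (ℕ.m+[n∸m]≡n i≤K)
  where
  go : ∀ l i → i + l ≡ K → Y i ≈ˢ F i +ˢ X *ˢ sumFrom i (suc l) Z
  go zero i i+0≡K rewrite ℕ.+-identityʳ i | i+0≡K =
    ≈ˢ-trans last (+ˢ-congˡ (F K) (*ˢ-congˡ X (≈ˢ-sym (+-identityʳ (Z K)))))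
  go (suc l) i i+l≡K = begin
    Y i
      ≈⟨ step i (subst (i <_) i+l≡K (ℕ.m<m+n i (s≤s z≤n))) ⟩
    Y (suc i) +ˢ -ˢ F (suc i) +ˢ F i +ˢ X *ˢ Z i
      ≈⟨ +ˢ-congʳ (X *ˢ Z i) (+ˢ-congʳ (F i) (+ˢ-congʳ (-ˢ F (suc i))
           (go l (suc i) (trans (sym (ℕ.+-suc i l)) i+l≡K)))) ⟩
    F (suc i) +ˢ X *ˢ S +ˢ -ˢ F (suc i) +ˢ F i +ˢ X *ˢ Z i
      ≈⟨ solve 5 (λ f′ f x s z → f′ :+ x :* s :- f′ :+ f :+ x :* z := f :+ x :* (z :+ s)) ≈ˢ-refl
           (F (suc i)) (F i) X S (Z i) ⟩
    F i +ˢ X *ˢ (Z i +ˢ S) ∎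
    where S = sumFrom (suc i) (suc l) Z

telescope-down : ∀ K (F Y Z : ℕ → Series) →
  Z 0 ≈ˢ F 0 +ˢ X *ˢ Y 0 →
  (∀ i → i < K → Z (suc i) ≈ˢ Z i +ˢ -ˢ F i +ˢ F (suc i) +ˢ X *ˢ Y (suc i)) →
  ∀ i → i ≤ K → Z i ≈ˢ F i +ˢ X *ˢ sumFrom 0 (suc i) Y
telescope-down K F Y Z first step zero    _    =
  ≈ˢ-trans first (+ˢ-congˡ (F 0) (*ˢ-congˡ X (≈ˢ-sym (+-identityʳ (Y 0)))))
telescope-down K F Y Z first step (suc i) i<K = begin
  Z (suc i)
    ≈⟨ step i i<K ⟩
  Z i +ˢ -ˢ F i +ˢ F (suc i) +ˢ X *ˢ Y (suc i)
    ≈⟨ +ˢ-congʳ (X *ˢ Y (suc i)) (+ˢ-congʳ (F (suc i)) (+ˢ-congʳ (-ˢ F i)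
         (telescope-down K F Y Z first step i (ℕ.<⇒≤ i<K)))) ⟩
  F i +ˢ X *ˢ sumFrom 0 (suc i) Y +ˢ -ˢ F i +ˢ F (suc i) +ˢ X *ˢ Y (suc i)
    ≈⟨ solve 5 (λ f f′ x s y → f :+ x :* s :- f :+ f′ :+ x :* y := f′ :+ x :* (s :+ y)) ≈ˢ-refl
         (F i) (F (suc i)) X (sumFrom 0 (suc i) Y) (Y (suc i)) ⟩
  F (suc i) +ˢ X *ˢ (sumFrom 0 (suc i) Y +ˢ Y (suc i))
    ≈⟨ +ˢ-congˡ (F (suc i)) (*ˢ-congˡ X (≈ˢ-sym (sumFrom-snoc 0 (suc i) Y))) ⟩
  F (suc i) +ˢ X *ˢ sumFrom 0 (suc (suc i)) Y ∎

sumFrom-*ˢ : ∀ i l Z D → sumFrom i l Z *ˢ D ≈ˢ sumFrom i l (λ b → Z b *ˢ D)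
sumFrom-*ˢ i zero    Z D = zeroˡ D
sumFrom-*ˢ i (suc l) Z D =
  ≈ˢ-trans (distribʳ D (Z i) (sumFrom (suc i) l Z)) (+ˢ-congˡ (Z i *ˢ D) (sumFrom-*ˢ (suc i) l Z D))

transferSolution-*ˢ : ∀ {K F Y Z} → IsTransferSolution K F Y Z → ∀ D →
  IsTransferSolution K (λ i → F i *ˢ D) (λ i → Y i *ˢ D) (λ i → Z i *ˢ D)
transferSolution-*ˢ {K} {F} {Y} {Z} sol D = record
  { up   = λ i i≤K → scale (up i i≤K) (sumFrom-*ˢ i (suc K ∸ i) Z D)
  ; down = λ i i≤K → scale (down i i≤K) (sumFrom-*ˢ 0 (suc i) Y D) }
  where
  open IsTransferSolution sol
  scale : ∀ {y f S S′} → y ≈ˢ f +ˢ X *ˢ S → S *ˢ D ≈ˢ S′ → y *ˢ D ≈ˢ f *ˢ D +ˢ X *ˢ S′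
  scale {y} {f} {S} y≈ SD≈ = begin
    y *ˢ D                   ≈⟨ *ˢ-congʳ D y≈ ⟩
    (f +ˢ X *ˢ S) *ˢ D
      ≈⟨ solve 4 (λ f x s d → (f :+ x :* s) :* d := f :* d :+ x :* (s :* d)) ≈ˢ-refl f X S D ⟩
    f *ˢ D +ˢ X *ˢ (S *ˢ D)  ≈⟨ +ˢ-congˡ (f *ˢ D) (*ˢ-congˡ X SD≈) ⟩
    f *ˢ D +ˢ X *ˢ _         ∎

sumFrom-coeff-cong : ∀ (Z Z′ : ℕ → Series) m i l → (∀ b → b < i + l → Z b m ≡ Z′ b m) →
  sumFrom i l Z m ≡ sumFrom i l Z′ m
sumFrom-coeff-cong Z Z′ m i zero    agree = refl
sumFrom-coeff-cong Z Z′ m i (suc l) agree =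
  cong₂ _+ℤ_ (agree i (ℕ.m<m+n i (s≤s z≤n)))
             (sumFrom-coeff-cong Z Z′ m (suc i) l λ b b< → agree b (subst (b <_) (sym (ℕ.+-suc i l)) b<))

+X*-coeff-cong : ∀ {f g} c S S′ m → f ≈ˢ c +ˢ X *ˢ S → g ≈ˢ c +ˢ X *ˢ S′ →
  X* S m ≡ X* S′ m → f m ≡ g m
+X*-coeff-cong c S S′ m f≈ g≈ eq =
  trans (coeff (≈ˢ-trans f≈ (+ˢ-congˡ c (≈ˢ-sym (X*≈X*ˢ S)))) m)
        (trans (cong (c m +ℤ_) eq) (coeff (≈ˢ-trans (+ˢ-congˡ c (X*≈X*ˢ S′)) (≈ˢ-sym g≈)) m))

transferSolution-unique : ∀ {K F Y Z Y′ Z′} → IsTransferSolution K F Y Z → IsTransferSolution K F Y′ Z′ →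
  ∀ m i → i ≤ K → Y i m ≡ Y′ i m × Z i m ≡ Z′ i m
transferSolution-unique {K} {F} {Y} {Z} {Y′} {Z′} sol sol′ = agree
  where
  open IsTransferSolution
  agree : ∀ m i → i ≤ K → Y i m ≡ Y′ i m × Z i m ≡ Z′ i m
  agree zero i i≤K = +X*-coeff-cong (F i) _ _ 0 (up sol i i≤K) (up sol′ i i≤K) refl
                    , +X*-coeff-cong (F i) _ _ 0 (down sol i i≤K) (down sol′ i i≤K) refl
  agree (suc m) i i≤K =
      +X*-coeff-cong (F i) (sumFrom i (suc K ∸ i) Z) (sumFrom i (suc K ∸ i) Z′) (suc m)
        (up sol i i≤K) (up sol′ i i≤K)
        (sumFrom-coeff-cong Z Z′ m i (suc K ∸ i) λ b b< → proj₂ (agree m b (ℕ.≤-pred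
          (subst (b <_) (ℕ.m+[n∸m]≡n (ℕ.m≤n⇒m≤1+n i≤K)) b<))))
    , +X*-coeff-cong (F i) (sumFrom 0 (suc i) Y) (sumFrom 0 (suc i) Y′) (suc m)
        (down sol i i≤K) (down sol′ i i≤K)
        (sumFrom-coeff-cong Y Y′ m 0 (suc i) λ b b≤i →
          proj₁ (agree m b (ℕ.≤-trans (ℕ.≤-pred b≤i) i≤K)))

-- Its explicit solution

δ : ℕ → ℕ → ℕ
δ zero    zero    = 1
δ zero    (suc _) = 0
δ (suc _) zero    = 0
δ (suc a) (suc b) = δ a b

δ-refl : ∀ a → δ a a ≡ 1
δ-refl zero    = refl
δ-refl (suc a) = δ-refl a

δ-≢ : ∀ {a b} → ¬ a ≡ b → δ a b ≡ 0
δ-≢ {zero}  {zero}  a≢b = ⊥-elim (a≢b refl)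
δ-≢ {zero}  {suc b} a≢b = refl
δ-≢ {suc a} {zero}  a≢b = refl
δ-≢ {suc a} {suc b} a≢b = δ-≢ (a≢b ∘ cong suc)

sgn-suc : ∀ e → sgn (suc e) ≡ - sgn e
sgn-suc e = ℤ.-1*i≡-i (sgn e)

sgn-2+ : ∀ e → sgn (suc (suc e)) ≡ sgn e
sgn-2+ e = trans (trans (sgn-suc (suc e)) (cong -_ (sgn-suc e))) (ℤ.neg-involutive (sgn e))

sgn-+-self : ∀ n → sgn (n + n) ≡ + 1
sgn-+-self zero    = refl
sgn-+-self (suc n) = trans (cong (sgn ∘ suc) (ℕ.+-suc n n)) (trans (sgn-2+ (n + n)) (sgn-+-self n))

sgn-shift : ∀ i j → sgn (suc i + suc j + 1) ≡ sgn (i + j + 1)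
sgn-shift i j = trans (cong (λ n → sgn (suc (n + 1))) (ℕ.+-suc i j)) (sgn-2+ (i + j + 1))

difference-cong : ∀ {p p′ f f′ g g′ q q′} → p ≈ˢ p′ → f ≈ˢ f′ → g ≈ˢ g′ → q ≈ˢ q′ →
  p +ˢ -ˢ f +ˢ g +ˢ X *ˢ q ≈ˢ p′ +ˢ -ˢ f′ +ˢ g′ +ˢ X *ˢ q′
difference-cong p f g q = +-cong (+-cong (+-cong p (-‿cong f)) g) (*ˢ-congˡ X q)

-- With k = K + 1, r = i + 1 and s = j + 1, P i is the sum of the two numerators of the
-- theorem (odd and even lengths), and Q i the corresponding numerator for sequences whose
-- first step goes down.
module ExplicitSolution (K j : ℕ) where

  σ : ℕ → Series
  σ i = const (sgn (i + j + 1))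

  D : Series
  D = Ueven (suc K)

  F : ℕ → Series
  F i = const (+ δ i j) *ˢ D

  G H : Series
  G = Uodd (K ∸ j) +ˢ Ueven (K ∸ j)
  H = Ueven j +ˢ Uodd j

  P : ℕ → Series
  P i with i ℕ.≤? j
  ... | yes _ = F i +ˢ σ i *ˢ X *ˢ (Ueven i *ˢ G)
  ... | no  _ = σ i *ˢ X *ˢ (H *ˢ Uodd (K ∸ i))

  Q : ℕ → Series
  Q i with i ℕ.<? j
  ... | yes _ = σ i *ˢ X *ˢ (G *ˢ Uodd i)
  ... | no  _ = F i +ˢ σ i *ˢ X *ˢ (H *ˢ Ueven (K ∸ i))

  P-≤ : ∀ {i} → i ≤ j → P i ≈ˢ F i +ˢ σ i *ˢ X *ˢ (Ueven i *ˢ G)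
  P-≤ {i} i≤j with i ℕ.≤? j
  ... | yes _  = ≈ˢ-refl
  ... | no i≰j = ⊥-elim (i≰j i≤j)

  P-> : ∀ {i} → j < i → P i ≈ˢ σ i *ˢ X *ˢ (H *ˢ Uodd (K ∸ i))
  P-> {i} j<i with i ℕ.≤? j
  ... | yes i≤j = ⊥-elim (ℕ.<⇒≱ j<i i≤j)
  ... | no  _   = ≈ˢ-refl

  Q-< : ∀ {i} → i < j → Q i ≈ˢ σ i *ˢ X *ˢ (G *ˢ Uodd i)
  Q-< {i} i<j with i ℕ.<? j
  ... | yes _  = ≈ˢ-refl
  ... | no i≮j = ⊥-elim (i≮j i<j)

  Q-≥ : ∀ {i} → j ≤ i → Q i ≈ˢ F i +ˢ σ i *ˢ X *ˢ (H *ˢ Ueven (K ∸ i))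
  Q-≥ {i} j≤i with i ℕ.<? j
  ... | yes i<j = ⊥-elim (ℕ.<⇒≱ i<j j≤i)
  ... | no  _   = ≈ˢ-refl

  F-self : F j ≈ˢ D
  F-self = ≈ˢ-trans (*ˢ-congʳ D (≈ˢ-trans (coeffwise λ m → cong (λ d → const (+ d) m) (δ-refl j)) const-1))
                   (*-identityˡ D)

  F-≢ : ∀ {i} → ¬ i ≡ j → F i ≈ˢ const (+ 0)
  F-≢ i≢j = ≈ˢ-trans (*ˢ-congʳ D (coeffwise λ m → cong (λ d → const (+ d) m) (δ-≢ i≢j))) (const0-*ˢ D)

  σ-suc : ∀ i → σ (suc i) ≈ˢ -ˢ σ i
  σ-suc i = coeffwise λ { zero → sgn-suc (i + j + 1) ; (suc m) → refl }

  σ-self : σ j ≈ˢ -ˢ const (+ 1)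
  σ-self = coeffwise λ
    { zero → trans (cong sgn (ℕ.+-comm (j + j) 1)) (trans (sgn-suc (j + j)) (cong -_ (sgn-+-self j)))
    ; (suc m) → refl }

  private
    c0 c1 : Series
    c0 = const (+ 0)
    c1 = const (+ 1)

  K∸i≡1+K∸1+i : ∀ {i} → i < K → K ∸ i ≡ suc (K ∸ suc i)
  K∸i≡1+K∸1+i i<K = ℕ.+-∸-assoc 1 i<K

  P-step-< : ∀ i → suc i ≤ j → P i ≈ˢ P (suc i) +ˢ -ˢ F (suc i) +ˢ F i +ˢ X *ˢ Q i
  P-step-< i i<j = begin
    P i
      ≈⟨ P-≤ (ℕ.<⇒≤ i<j) ⟩
    F i +ˢ σ i *ˢ X *ˢ (Ueven i *ˢ G)
      ≈⟨ solve 7 (λ f f′ s x e o g → f :+ s :* x :* (e :* g) :=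
           f′ :+ (:- s) :* x :* ((x :* o :- e) :* g) :- f′ :+ f :+ x :* (s :* x :* (g :* o))) ≈ˢ-refl
           (F i) (F (suc i)) (σ i) X (Ueven i) (Uodd i) G ⟩
    F (suc i) +ˢ (-ˢ σ i) *ˢ X *ˢ ((X *ˢ Uodd i +ˢ -ˢ Ueven i) *ˢ G) +ˢ -ˢ F (suc i) +ˢ F i
      +ˢ X *ˢ (σ i *ˢ X *ˢ (G *ˢ Uodd i))
      ≈⟨ difference-cong (≈ˢ-sym P-next) ≈ˢ-refl ≈ˢ-refl (≈ˢ-sym (Q-< i<j)) ⟩
    P (suc i) +ˢ -ˢ F (suc i) +ˢ F i +ˢ X *ˢ Q i ∎
    where
    P-next : P (suc i) ≈ˢ F (suc i) +ˢ (-ˢ σ i) *ˢ X *ˢ ((X *ˢ Uodd i +ˢ -ˢ Ueven i) *ˢ G)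
    P-next = ≈ˢ-trans (P-≤ i<j)
      (+ˢ-congˡ (F (suc i)) (*-cong (*ˢ-congʳ X (σ-suc i)) (*ˢ-congʳ G (Ueven-suc i))))

  P-step-> : ∀ i → j < i → i < K → P i ≈ˢ P (suc i) +ˢ -ˢ F (suc i) +ˢ F i +ˢ X *ˢ Q i
  P-step-> i j<i i<K = begin
    P i
      ≈⟨ ≈ˢ-trans (P-> j<i) (*ˢ-congˡ (σ i *ˢ X) (*ˢ-congˡ H
           (≈ˢ-trans (≈ˢ-reflexive (cong Uodd (K∸i≡1+K∸1+i i<K))) (Uodd-suc t)))) ⟩
    σ i *ˢ X *ˢ (H *ˢ (X *ˢ Ueven (suc t) +ˢ -ˢ Uodd t))
      ≈⟨ solve 5 (λ s x h q o → s :* x :* (h :* (x :* q :- o)) :=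
           (:- s) :* x :* (h :* o) :- con (+ 0) :+ con (+ 0) :+ x :* (con (+ 0) :+ s :* x :* (h :* q)))
           ≈ˢ-refl (σ i) X H (Ueven (suc t)) (Uodd t) ⟩
    (-ˢ σ i) *ˢ X *ˢ (H *ˢ Uodd t) +ˢ -ˢ c0 +ˢ c0 +ˢ X *ˢ (c0 +ˢ σ i *ˢ X *ˢ (H *ˢ Ueven (suc t)))
      ≈⟨ difference-cong (≈ˢ-sym P-next) (≈ˢ-sym (F-≢ j≢1+i)) (≈ˢ-sym (F-≢ j≢i)) (≈ˢ-sym Q-here) ⟩
    P (suc i) +ˢ -ˢ F (suc i) +ˢ F i +ˢ X *ˢ Q i ∎
    where
    t = K ∸ suc i
    j≢i : ¬ i ≡ j
    j≢i i≡j = ℕ.<-irrefl (sym i≡j) j<i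
    j≢1+i : ¬ suc i ≡ j
    j≢1+i 1+i≡j = ℕ.<-irrefl (sym 1+i≡j) (ℕ.m<n⇒m<1+n j<i)
    P-next : P (suc i) ≈ˢ (-ˢ σ i) *ˢ X *ˢ (H *ˢ Uodd t)
    P-next = ≈ˢ-trans (P-> (ℕ.m<n⇒m<1+n j<i)) (*ˢ-congʳ (H *ˢ Uodd t) (*ˢ-congʳ X (σ-suc i)))
    Q-here : Q i ≈ˢ c0 +ˢ σ i *ˢ X *ˢ (H *ˢ Ueven (suc t))
    Q-here = ≈ˢ-trans (Q-≥ (ℕ.<⇒≤ j<i)) (+-cong (F-≢ j≢i)
      (*ˢ-congˡ (σ i *ˢ X) (*ˢ-congˡ H (≈ˢ-reflexive (cong Ueven (K∸i≡1+K∸1+i i<K))))))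

  P-step-= : j < K → P j ≈ˢ P (suc j) +ˢ -ˢ F (suc j) +ˢ F j +ˢ X *ˢ Q j
  P-step-= j<K = begin
    P j
      ≈⟨ ≈ˢ-trans (P-≤ ℕ.≤-refl)
           (+-cong F-here (*-cong (*ˢ-congʳ X σ-self) (*ˢ-congˡ (Ueven j) G-here))) ⟩
    d +ˢ (-ˢ c1) *ˢ X *ˢ (Ueven j *ˢ (X *ˢ q +ˢ -ˢ o +ˢ q))
      ≈⟨ solve 5 (λ x a b q o →
           (a :* (x :* q :- o) :- (b :* q)) :+ (:- con (+ 1)) :* x :* (b :* ((x :* q :- o) :+ q)) :=
           (:- (:- con (+ 1))) :* x :* ((b :+ a) :* o) :- con (+ 0) :+ (a :* (x :* q :- o) :- (b :* q))
             :+ x :* ((a :* (x :* q :- o) :- (b :* q)) :+ (:- con (+ 1)) :* x :* ((b :+ a) :* q)))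
           ≈ˢ-refl X (Uodd j) (Ueven j) q o ⟩
    (-ˢ (-ˢ c1)) *ˢ X *ˢ (H *ˢ o) +ˢ -ˢ c0 +ˢ d +ˢ X *ˢ (d +ˢ (-ˢ c1) *ˢ X *ˢ (H *ˢ q))
      ≈⟨ difference-cong (≈ˢ-sym P-next) (≈ˢ-sym (F-≢ 1+j≢j)) (≈ˢ-sym F-here) (≈ˢ-sym Q-here) ⟩
    P (suc j) +ˢ -ˢ F (suc j) +ˢ F j +ˢ X *ˢ Q j ∎
    where
    t = K ∸ suc j
    q = Ueven (suc t)
    o = Uodd t
    d = Uodd j *ˢ (X *ˢ q +ˢ -ˢ o) +ˢ -ˢ (Ueven j *ˢ q)
    1+j≢j : ¬ suc j ≡ j
    1+j≢j 1+j≡j = ℕ.<-irrefl (sym 1+j≡j) (ℕ.n<1+n j)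
    F-here : F j ≈ˢ d
    F-here = begin
      F j                                          ≈⟨ F-self ⟩
      Ueven (suc K)                                ≡⟨ cong (Ueven ∘ suc) K≡j+1+t ⟩
      Ueven (suc (j + suc t))                      ≈⟨ Ueven-+ j (suc t) ⟩
      Uodd j *ˢ Uodd (suc t) +ˢ -ˢ (Ueven j *ˢ q)
        ≈⟨ +ˢ-congʳ (-ˢ (Ueven j *ˢ q)) (*ˢ-congˡ (Uodd j) (Uodd-suc t)) ⟩
      d                                            ∎
      where
      K≡j+1+t : K ≡ j + suc t
      K≡j+1+t = trans (sym (ℕ.m+[n∸m]≡n (ℕ.<⇒≤ j<K))) (cong (λ n → j + n) (K∸i≡1+K∸1+i j<K))
    G-here : G ≈ˢ X *ˢ q +ˢ -ˢ o +ˢ q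
    G-here = ≈ˢ-trans (≈ˢ-reflexive (cong (λ n → Uodd n +ˢ Ueven n) (K∸i≡1+K∸1+i j<K)))
                      (+ˢ-congʳ q (Uodd-suc t))
    P-next : P (suc j) ≈ˢ (-ˢ (-ˢ c1)) *ˢ X *ˢ (H *ˢ o)
    P-next = ≈ˢ-trans (P-> (ℕ.n<1+n j))
      (*ˢ-congʳ (H *ˢ o) (*ˢ-congʳ X (≈ˢ-trans (σ-suc j) (-‿cong σ-self))))
    Q-here : Q j ≈ˢ d +ˢ (-ˢ c1) *ˢ X *ˢ (H *ˢ q)
    Q-here = ≈ˢ-trans (Q-≥ ℕ.≤-refl) (+-cong F-here (*-cong (*ˢ-congʳ X σ-self)
      (*ˢ-congˡ H (≈ˢ-reflexive (cong Ueven (K∸i≡1+K∸1+i j<K))))))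

  P-last-< : j < K → P K ≈ˢ F K +ˢ X *ˢ Q K
  P-last-< j<K = begin
    P K
      ≈⟨ ≈ˢ-trans (P-> j<K)
           (*ˢ-congˡ (σ K *ˢ X) (*ˢ-congˡ H (≈ˢ-reflexive (cong Uodd (ℕ.n∸n≡0 K))))) ⟩
    σ K *ˢ X *ˢ (H *ˢ X)
      ≈⟨ solve 3 (λ s x h → s :* x :* (h :* x) := con (+ 0) :+ x :* (con (+ 0) :+ s :* x :* (h :* con (+ 1))))
           ≈ˢ-refl (σ K) X H ⟩
    c0 +ˢ X *ˢ (c0 +ˢ σ K *ˢ X *ˢ (H *ˢ c1))
      ≈⟨ ≈ˢ-sym (+-cong F-last (*ˢ-congˡ X Q-last)) ⟩
    F K +ˢ X *ˢ Q K ∎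
    where
    F-last : F K ≈ˢ c0
    F-last = F-≢ λ K≡j → ℕ.<-irrefl (sym K≡j) j<K
    Q-last : Q K ≈ˢ c0 +ˢ σ K *ˢ X *ˢ (H *ˢ c1)
    Q-last = ≈ˢ-trans (Q-≥ (ℕ.<⇒≤ j<K)) (+-cong F-last (*ˢ-congˡ (σ K *ˢ X) (*ˢ-congˡ H
      (≈ˢ-trans (≈ˢ-reflexive (cong Ueven (ℕ.n∸n≡0 K))) (≈ˢ-sym const-1)))))

  P-last-= : j ≡ K → P K ≈ˢ F K +ˢ X *ˢ Q K
  P-last-= refl = begin
    P j
      ≈⟨ ≈ˢ-trans (P-≤ ℕ.≤-refl)
           (+-cong F-here (*-cong (*ˢ-congʳ X σ-self) (*ˢ-congˡ (Ueven j) G-here))) ⟩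
    d +ˢ (-ˢ c1) *ˢ X *ˢ (Ueven j *ˢ (X +ˢ c1))
      ≈⟨ solve 3 (λ x e o → (x :* o :- e) :+ (:- con (+ 1)) :* x :* (e :* (x :+ con (+ 1))) :=
           (x :* o :- e) :+ x :* ((x :* o :- e) :+ (:- con (+ 1)) :* x :* ((e :+ o) :* con (+ 1))))
           ≈ˢ-refl X (Ueven j) (Uodd j) ⟩
    d +ˢ X *ˢ (d +ˢ (-ˢ c1) *ˢ X *ˢ (H *ˢ c1))
      ≈⟨ ≈ˢ-sym (+-cong F-here (*ˢ-congˡ X (≈ˢ-trans (Q-≥ ℕ.≤-refl)
           (+-cong F-here (*-cong (*ˢ-congʳ X σ-self) (*ˢ-congˡ H Ueven-0)))))) ⟩
    F j +ˢ X *ˢ Q j ∎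
    where
    d = X *ˢ Uodd j +ˢ -ˢ Ueven j
    F-here : F j ≈ˢ d
    F-here = ≈ˢ-trans F-self (Ueven-suc j)
    Ueven-0 : Ueven (j ∸ j) ≈ˢ c1
    Ueven-0 = ≈ˢ-trans (≈ˢ-reflexive (cong Ueven (ℕ.n∸n≡0 j))) (≈ˢ-sym const-1)
    G-here : G ≈ˢ X +ˢ c1
    G-here = +-cong (≈ˢ-reflexive (cong Uodd (ℕ.n∸n≡0 j))) Ueven-0

  Q-first-< : 0 < j → Q 0 ≈ˢ F 0 +ˢ X *ˢ P 0
  Q-first-< 0<j = begin
    Q 0
      ≈⟨ Q-< 0<j ⟩
    σ 0 *ˢ X *ˢ (G *ˢ X)
      ≈⟨ solve 3 (λ s x g → s :* x :* (g :* x) := con (+ 0) :+ x :* (con (+ 0) :+ s :* x :* (con (+ 1) :* g)))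
           ≈ˢ-refl (σ 0) X G ⟩
    c0 +ˢ X *ˢ (c0 +ˢ σ 0 *ˢ X *ˢ (c1 *ˢ G))
      ≈⟨ ≈ˢ-sym (+-cong F-first (*ˢ-congˡ X (≈ˢ-trans (P-≤ {0} z≤n)
           (+-cong F-first (*ˢ-congˡ (σ 0 *ˢ X) (*ˢ-congʳ G (≈ˢ-sym const-1))))))) ⟩
    F 0 +ˢ X *ˢ P 0 ∎
    where
    F-first : F 0 ≈ˢ c0
    F-first = F-≢ λ 0≡j → ℕ.<-irrefl 0≡j 0<j

  Q-first-= : j ≡ 0 → Q 0 ≈ˢ F 0 +ˢ X *ˢ P 0
  Q-first-= refl = begin
    Q 0
      ≈⟨ ≈ˢ-trans (Q-≥ {0} z≤n) (+-cong F-here (*-cong (*ˢ-congʳ X σ-self) (*ˢ-congʳ (Ueven K) H-here))) ⟩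
    d +ˢ (-ˢ c1) *ˢ X *ˢ ((c1 +ˢ X) *ˢ Ueven K)
      ≈⟨ solve 3 (λ x e o → (x :* o :- e) :+ (:- con (+ 1)) :* x :* ((con (+ 1) :+ x) :* e) :=
           (x :* o :- e) :+ x :* ((x :* o :- e) :+ (:- con (+ 1)) :* x :* (con (+ 1) :* (o :+ e))))
           ≈ˢ-refl X (Ueven K) (Uodd K) ⟩
    d +ˢ X *ˢ (d +ˢ (-ˢ c1) *ˢ X *ˢ (c1 *ˢ G))
      ≈⟨ ≈ˢ-sym (+-cong F-here (*ˢ-congˡ X (≈ˢ-trans (P-≤ {0} z≤n)
           (+-cong F-here (*-cong (*ˢ-congʳ X σ-self) (*ˢ-congʳ G (≈ˢ-sym const-1))))))) ⟩
    F 0 +ˢ X *ˢ P 0 ∎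
    where
    d = X *ˢ Uodd K +ˢ -ˢ Ueven K
    F-here : F 0 ≈ˢ d
    F-here = ≈ˢ-trans F-self (Ueven-suc K)
    H-here : H ≈ˢ c1 +ˢ X
    H-here = +ˢ-congʳ X (≈ˢ-sym const-1)

  Q-step-< : ∀ i → suc (suc i) ≤ j → Q (suc i) ≈ˢ Q i +ˢ -ˢ F i +ˢ F (suc i) +ˢ X *ˢ P (suc i)
  Q-step-< i 2+i≤j = begin
    Q (suc i)
      ≈⟨ ≈ˢ-trans (Q-< 2+i≤j) (*-cong (*ˢ-congʳ X (σ-suc i)) (*ˢ-congˡ G (Uodd-suc i))) ⟩
    (-ˢ σ i) *ˢ X *ˢ (G *ˢ (X *ˢ Ueven (suc i) +ˢ -ˢ Uodd i))
      ≈⟨ solve 5 (λ s x g e o → (:- s) :* x :* (g :* (x :* e :- o)) :=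
           s :* x :* (g :* o) :- con (+ 0) :+ con (+ 0) :+ x :* (con (+ 0) :+ (:- s) :* x :* (e :* g)))
           ≈ˢ-refl (σ i) X G (Ueven (suc i)) (Uodd i) ⟩
    σ i *ˢ X *ˢ (G *ˢ Uodd i) +ˢ -ˢ c0 +ˢ c0 +ˢ X *ˢ (c0 +ˢ (-ˢ σ i) *ˢ X *ˢ (Ueven (suc i) *ˢ G))
      ≈⟨ ≈ˢ-sym (difference-cong (Q-< i<j) (F-≢ i≢j) (F-≢ 1+i≢j) P-next) ⟩
    Q i +ˢ -ˢ F i +ˢ F (suc i) +ˢ X *ˢ P (suc i) ∎
    where
    i<j : i < j
    i<j = ℕ.<-trans (ℕ.n<1+n i) 2+i≤j
    i≢j : ¬ i ≡ j
    i≢j i≡j = ℕ.<-irrefl i≡j i<j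
    1+i≢j : ¬ suc i ≡ j
    1+i≢j 1+i≡j = ℕ.<-irrefl 1+i≡j 2+i≤j
    P-next : P (suc i) ≈ˢ c0 +ˢ (-ˢ σ i) *ˢ X *ˢ (Ueven (suc i) *ˢ G)
    P-next = ≈ˢ-trans (P-≤ (ℕ.<⇒≤ 2+i≤j))
      (+-cong (F-≢ 1+i≢j) (*ˢ-congʳ (Ueven (suc i) *ˢ G) (*ˢ-congʳ X (σ-suc i))))

  Q-step-= : ∀ i → j ≡ suc i → i < K → Q (suc i) ≈ˢ Q i +ˢ -ˢ F i +ˢ F (suc i) +ˢ X *ˢ P (suc i)
  Q-step-= i refl i<K = begin
    Q (suc i)
      ≈⟨ ≈ˢ-trans (Q-≥ ℕ.≤-refl) (+-cong F-here (*-cong (*ˢ-congʳ X σ-self)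
           (*ˢ-congʳ (Ueven t) (+ˢ-congˡ e (Uodd-suc i))))) ⟩
    d +ˢ (-ˢ c1) *ˢ X *ˢ ((e +ˢ (X *ˢ e +ˢ -ˢ o)) *ˢ Ueven t)
      ≈⟨ solve 5 (λ x e o p q →
           ((x :* e :- o) :* p :- (e :* q)) :+ (:- con (+ 1)) :* x :* ((e :+ (x :* e :- o)) :* q) :=
           con (+ 1) :* x :* ((p :+ q) :* o) :- con (+ 0) :+ ((x :* e :- o) :* p :- (e :* q))
             :+ x :* (((x :* e :- o) :* p :- (e :* q)) :+ (:- con (+ 1)) :* x :* (e :* (p :+ q))))
           ≈ˢ-refl X e o (Uodd t) (Ueven t) ⟩
    c1 *ˢ X *ˢ (G *ˢ o) +ˢ -ˢ c0 +ˢ d +ˢ X *ˢ (d +ˢ (-ˢ c1) *ˢ X *ˢ (e *ˢ G))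
      ≈⟨ ≈ˢ-sym (difference-cong Q-here (F-≢ i≢1+i) F-here P-next) ⟩
    Q i +ˢ -ˢ F i +ˢ F (suc i) +ˢ X *ˢ P (suc i) ∎
    where
    t = K ∸ suc i
    e = Ueven (suc i)
    o = Uodd i
    d = (X *ˢ e +ˢ -ˢ o) *ˢ Uodd t +ˢ -ˢ (e *ˢ Ueven t)
    i≢1+i : ¬ i ≡ suc i
    i≢1+i i≡1+i = ℕ.<-irrefl i≡1+i ℕ.≤-refl
    F-here : F (suc i) ≈ˢ d
    F-here = begin
      F (suc i)                        ≈⟨ F-self ⟩
      Ueven (suc K)                    ≡⟨ cong (Ueven ∘ suc) (sym (ℕ.m+[n∸m]≡n i<K)) ⟩
      Ueven (suc (suc i + t))          ≈⟨ Ueven-+ (suc i) t ⟩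
      Uodd (suc i) *ˢ Uodd t +ˢ -ˢ (e *ˢ Ueven t)
        ≈⟨ +ˢ-congʳ (-ˢ (e *ˢ Ueven t)) (*ˢ-congʳ (Uodd t) (Uodd-suc i)) ⟩
      d                                ∎
    σ-prev : σ i ≈ˢ c1
    σ-prev = coeffwise λ
      { zero → trans (cong sgn (ℕ.+-comm (i + suc i) 1)) (sgn-+-self (suc i)) ; (suc m) → refl }
    Q-here : Q i ≈ˢ c1 *ˢ X *ˢ (G *ˢ o)
    Q-here = ≈ˢ-trans (Q-< ℕ.≤-refl) (*ˢ-congʳ (G *ˢ o) (*ˢ-congʳ X σ-prev))
    P-next : P (suc i) ≈ˢ d +ˢ (-ˢ c1) *ˢ X *ˢ (e *ˢ G)
    P-next = ≈ˢ-trans (P-≤ ℕ.≤-refl) (+-cong F-here (*ˢ-congʳ (e *ˢ G) (*ˢ-congʳ X σ-self)))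

  Q-step-≥ : ∀ i → j ≤ i → i < K → Q (suc i) ≈ˢ Q i +ˢ -ˢ F i +ˢ F (suc i) +ˢ X *ˢ P (suc i)
  Q-step-≥ i j≤i i<K = begin
    Q (suc i)
      ≈⟨ ≈ˢ-trans (Q-≥ (ℕ.m≤n⇒m≤1+n j≤i))
           (+ˢ-congˡ (F (suc i)) (*ˢ-congʳ (H *ˢ Ueven t) (*ˢ-congʳ X (σ-suc i)))) ⟩
    F (suc i) +ˢ (-ˢ σ i) *ˢ X *ˢ (H *ˢ Ueven t)
      ≈⟨ solve 7 (λ f f′ s x h q o → f′ :+ (:- s) :* x :* (h :* q) :=
           f :+ s :* x :* (h :* (x :* o :- q)) :- f :+ f′ :+ x :* ((:- s) :* x :* (h :* o)))
           ≈ˢ-refl (F i) (F (suc i)) (σ i) X H (Ueven t) (Uodd t) ⟩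
    F i +ˢ σ i *ˢ X *ˢ (H *ˢ (X *ˢ Uodd t +ˢ -ˢ Ueven t)) +ˢ -ˢ F i +ˢ F (suc i)
      +ˢ X *ˢ ((-ˢ σ i) *ˢ X *ˢ (H *ˢ Uodd t))
      ≈⟨ ≈ˢ-sym (difference-cong Q-here ≈ˢ-refl ≈ˢ-refl P-next) ⟩
    Q i +ˢ -ˢ F i +ˢ F (suc i) +ˢ X *ˢ P (suc i) ∎
    where
    t = K ∸ suc i
    Q-here : Q i ≈ˢ F i +ˢ σ i *ˢ X *ˢ (H *ˢ (X *ˢ Uodd t +ˢ -ˢ Ueven t))
    Q-here = ≈ˢ-trans (Q-≥ j≤i) (+ˢ-congˡ (F i) (*ˢ-congˡ (σ i *ˢ X) (*ˢ-congˡ H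
      (≈ˢ-trans (≈ˢ-reflexive (cong Ueven (K∸i≡1+K∸1+i i<K))) (Ueven-suc t)))))
    P-next : P (suc i) ≈ˢ (-ˢ σ i) *ˢ X *ˢ (H *ˢ Uodd t)
    P-next = ≈ˢ-trans (P-> (s≤s j≤i)) (*ˢ-congʳ (H *ˢ Uodd t) (*ˢ-congʳ X (σ-suc i)))

  P-step : ∀ i → i < K → P i ≈ˢ P (suc i) +ˢ -ˢ F (suc i) +ˢ F i +ˢ X *ˢ Q i
  P-step i i<K with ℕ.<-cmp i j
  ... | tri< i<j _ _  = P-step-< i i<j
  ... | tri≈ _ refl _ = P-step-= i<K
  ... | tri> _ _ j<i  = P-step-> i j<i i<K

  P-last : j ≤ K → P K ≈ˢ F K +ˢ X *ˢ Q K
  P-last j≤K with ℕ.m≤n⇒m<n∨m≡n j≤K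
  ... | inj₁ j<K = P-last-< j<K
  ... | inj₂ j≡K = P-last-= j≡K

  Q-first : Q 0 ≈ˢ F 0 +ˢ X *ˢ P 0
  Q-first with j ℕ.≟ 0
  ... | yes j≡0 = Q-first-= j≡0
  ... | no  j≢0 = Q-first-< (ℕ.n≢0⇒n>0 j≢0)

  Q-step : ∀ i → i < K → Q (suc i) ≈ˢ Q i +ˢ -ˢ F i +ˢ F (suc i) +ˢ X *ˢ P (suc i)
  Q-step i i<K with ℕ.<-cmp (suc i) j
  ... | tri< 2+i≤j _ _   = Q-step-< i 2+i≤j
  ... | tri≈ _ 1+i≡j _   = Q-step-= i (sym 1+i≡j) i<K
  ... | tri> _ _ j<1+i   = Q-step-≥ i (ℕ.≤-pred j<1+i) i<K

  isTransferSolution : j ≤ K → IsTransferSolution K F P Q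
  isTransferSolution j≤K = record
    { up   = telescope-up K F P Q P-step (P-last j≤K)
    ; down = telescope-down K F P Q Q-first Q-step }

-- Counting alternating sequences

sumℕFrom : ℕ → ℕ → (ℕ → ℕ) → ℕ
sumℕFrom r zero    f = 0
sumℕFrom r (suc l) f = f r + sumℕFrom (suc r) l f


-- upCount n r is |𝒜ₙ⁽ᵏ⁾(r → s)|; downCount n r counts the sequences that alternate the
-- other way round, a₁ ≥ a₂ ≤ a₃ ≥ ⋯.
module Counting (k s : ℕ) where
  upCount downCount : ℕ → ℕ → ℕ
  upCount   zero          r = 0
  upCount   (suc zero)    r = δ r s
  upCount   (suc (suc n)) r = sumℕFrom r (suc k ∸ r) (downCount (suc n))
  downCount zero          r = 0
  downCount (suc zero)    r = δ r s
  downCount (suc (suc n)) r = sumℕFrom 1 r (upCount (suc n))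

¬⇒↔Fin0 : ∀ {A : Set} → ¬ A → A ↔ Fin 0
¬⇒↔Fin0 ¬a = mk↔ₛ′ (λ a → ⊥-elim (¬a a)) (λ ()) (λ ()) (λ a → ⊥-elim (¬a a))

×-contractˡ : ∀ {P A : Set} → P → (∀ (p q : P) → p ≡ q) → (P × A) ↔ A
×-contractˡ p irr = mk↔ₛ′ proj₂ (p ,_) (λ _ → refl) (λ (q , a) → cong (_, a) (irr p q))

Σℕ↔zero⊎suc : ∀ (T : ℕ → Set) → Σ ℕ T ↔ (T 0 ⊎ Σ ℕ (T ∘ suc))
Σℕ↔zero⊎suc T =
  mk↔ₛ′ to from (λ { (inj₁ _) → refl ; (inj₂ _) → refl }) (λ { (zero , _) → refl ; (suc _ , _) → refl })
  where
  to : Σ ℕ T → T 0 ⊎ Σ ℕ (T ∘ suc)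
  to (zero  , t) = inj₁ t
  to (suc d , t) = inj₂ (d , t)
  from : T 0 ⊎ Σ ℕ (T ∘ suc) → Σ ℕ T
  from (inj₁ t)       = zero , t
  from (inj₂ (d , t)) = suc d , t

Σℕ↔Fin-sumℕFrom : ∀ (T : ℕ → Set) f r l →
  (∀ d → d < l → T d ↔ Fin (f (r + d))) → (∀ d → l ≤ d → ¬ T d) → Σ ℕ T ↔ Fin (sumℕFrom r l f)
Σℕ↔Fin-sumℕFrom T f r zero    count empty = ¬⇒↔Fin0 λ (d , t) → empty d z≤n t
Σℕ↔Fin-sumℕFrom T f r (suc l) count empty =
  ↔-trans (Σℕ↔zero⊎suc T) (↔-trans (head-count ⊎-↔ tail-count) (↔-sym Fin.+↔⊎))
  where
  head-count : T 0 ↔ Fin (f r)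
  head-count = subst (λ n → T 0 ↔ Fin (f n)) (ℕ.+-identityʳ r) (count 0 (s≤s z≤n))
  tail-count : Σ ℕ (T ∘ suc) ↔ Fin (sumℕFrom (suc r) l f)
  tail-count = Σℕ↔Fin-sumℕFrom (T ∘ suc) f (suc r) l
    (λ d d<l → subst (λ n → T (suc d) ↔ Fin (f n)) (ℕ.+-suc r d) (count (suc d) (s≤s d<l)))
    (λ d l≤d → empty (suc d) (s≤s l≤d))

<∸⇒+≤ : ∀ {r d k} → r ≤ k → d < suc k ∸ r → r + d ≤ k
<∸⇒+≤ {r} {d} {k} r≤k d< =
  subst (_≤ k) (ℕ.+-comm d r) (ℕ.≤-pred (ℕ.m≤o∸n⇒m+n≤o (suc d) (ℕ.m≤n⇒m≤1+n r≤k) d<))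

+≤⇒<∸ : ∀ {r d k} → r ≤ k → r + d ≤ k → d < suc k ∸ r
+≤⇒<∸ {r} {d} {k} r≤k r+d≤k =
  subst (d <_) (sym (ℕ.+-∸-assoc 1 r≤k)) (s≤s (ℕ.m+n≤o⇒m≤o∸n d (subst (_≤ k) (ℕ.+-comm r d) r+d≤k)))

module Sequences (k s : ℕ) where

  Bounded : ℕ → Set
  Bounded a = 1 ≤ a × a ≤ k

  Bounded-irrelevant : ∀ {a} (p q : Bounded a) → p ≡ q
  Bounded-irrelevant (p₁ , p₂) (q₁ , q₂) = cong₂ _,_ (ℕ.≤-irrelevant p₁ q₁) (ℕ.≤-irrelevant p₂ q₂)

  Seq : (List ℕ → Set) → ℕ → ℕ → Set
  Seq Alt n r = Σ (Vec ℕ n) λ v →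
    All Bounded v × (head (toList v) ≡ just r) × (last (toList v) ≡ just s) × Alt (toList v)

  Seq-empty : ∀ {Alt r} → ¬ Seq Alt 0 r
  Seq-empty ([] , _ , () , _)

  Seq-single : ∀ (Alt : List ℕ → Set) → (∀ a → Alt (a ∷ [])) →
    (∀ a (p q : Alt (a ∷ [])) → p ≡ q) → ∀ r → Bounded r → Seq Alt 1 r ↔ Fin (δ r s)
  Seq-single Alt alt alt-irr r br with r ℕ.≟ s
  ... | yes refl = subst (λ n → Seq Alt 1 r ↔ Fin n) (sym (δ-refl r)) (mk↔ₛ′
          (λ _ → Fin.zero)
          (λ _ → (r ∷ []) , (br ∷ []) , refl , refl , alt r)
          (λ { Fin.zero → refl ; (Fin.suc ()) })
          (λ { ((a ∷ []) , (ba ∷ []) , refl , refl , t) →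
                 cong₂ (λ b t → (a ∷ []) , (b ∷ []) , refl , refl , t)
                       (Bounded-irrelevant br ba) (alt-irr a _ t) }))
  ... | no  r≢s  = subst (λ n → Seq Alt 1 r ↔ Fin n) (sym (δ-≢ r≢s))
          (¬⇒↔Fin0 λ { ((a ∷ []) , _ , refl , a≡s , _) → r≢s (just-injective a≡s) })

  Seq-up-step : ∀ n r → Bounded r → Seq AltUp (suc (suc n)) r ↔ Σ ℕ (λ d → Seq AltDown (suc n) (r + d))
  Seq-up-step n r br = mk↔ₛ′ to from to-from from-to
    where
    to : Seq AltUp (suc (suc n)) r → Σ ℕ (λ d → Seq AltDown (suc n) (r + d))
    to ((a ∷ b ∷ w) , (_ ∷ bb ∷ bw) , a≡r , l≡s , (a≤b , alt)) =
      b ∸ r , (b ∷ w) , (bb ∷ bw) , cong just (sym (ℕ.m+[n∸m]≡n (subst (_≤ b) (just-injective a≡r) a≤b)))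
            , l≡s , alt
    from : Σ ℕ (λ d → Seq AltDown (suc n) (r + d)) → Seq AltUp (suc (suc n)) r
    from (d , (b ∷ w) , (bb ∷ bw) , b≡r+d , l≡s , alt) =
      (r ∷ b ∷ w) , (br ∷ bb ∷ bw) , refl , l≡s
                  , (subst (r ≤_) (sym (just-injective b≡r+d)) (ℕ.m≤m+n r d) , alt)
    to-from : ∀ y → to (from y) ≡ y
    to-from (d , (b ∷ w) , (bb ∷ bw) , refl , l≡s , alt) = same-offset (ℕ.m+n∸m≡n r d) _
      where
      same-offset : ∀ {e} → e ≡ d → (b≡r+e : just (r + d) ≡ just (r + e)) →
        _≡_ {A = Σ ℕ (λ d → Seq AltDown (suc n) (r + d))}
            (e , (r + d ∷ w) , (bb ∷ bw) , b≡r+e , l≡s , alt) (d , (r + d ∷ w) , (bb ∷ bw) , refl , l≡s , alt)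
      same-offset refl b≡r+e =
        cong (λ p → d , (r + d ∷ w) , (bb ∷ bw) , p , l≡s , alt) (≡-irrelevant b≡r+e refl)
    from-to : ∀ x → from (to x) ≡ x
    from-to ((a ∷ b ∷ w) , (ba ∷ bb ∷ bw) , refl , l≡s , (a≤b , alt)) =
      cong₂ (λ p q → (a ∷ b ∷ w) , (p ∷ bb ∷ bw) , refl , l≡s , (q , alt))
            (Bounded-irrelevant br ba) (ℕ.≤-irrelevant _ _)

  Seq-down-step : ∀ n r → Bounded r →
    Seq AltDown (suc (suc n)) r ↔ Σ ℕ (λ d → suc d ≤ r × Seq AltUp (suc n) (suc d))
  Seq-down-step n r br = mk↔ₛ′ to from to-from from-to
    where
    to : Seq AltDown (suc (suc n)) r → Σ ℕ (λ d → suc d ≤ r × Seq AltUp (suc n) (suc d))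
    to ((a ∷ suc d ∷ w) , (_ ∷ bb ∷ bw) , a≡r , l≡s , (a≥b , alt)) =
      d , subst (suc d ≤_) (just-injective a≡r) a≥b , (suc d ∷ w) , (bb ∷ bw) , refl , l≡s , alt
    from : Σ ℕ (λ d → suc d ≤ r × Seq AltUp (suc n) (suc d)) → Seq AltDown (suc (suc n)) r
    from (d , b≤r , (b ∷ w) , (bb ∷ bw) , b≡1+d , l≡s , alt) =
      (r ∷ b ∷ w) , (br ∷ bb ∷ bw) , refl , l≡s , (subst (_≤ r) (sym (just-injective b≡1+d)) b≤r , alt)
    to-from : ∀ y → to (from y) ≡ y
    to-from (d , b≤r , (.(suc d) ∷ w) , ((s≤s z≤n , b≤k) ∷ bw) , refl , l≡s , alt) =
      cong (λ p → d , p , (suc d ∷ w) , ((s≤s z≤n , b≤k) ∷ bw) , refl , l≡s , alt) (ℕ.≤-irrelevant _ _)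
    from-to : ∀ x → from (to x) ≡ x
    from-to ((a ∷ suc d ∷ w) , (ba ∷ bb ∷ bw) , refl , l≡s , (a≥b , alt)) =
      cong₂ (λ p q → (a ∷ suc d ∷ w) , (p ∷ bb ∷ bw) , refl , l≡s , (q , alt))
            (Bounded-irrelevant br ba) (ℕ.≤-irrelevant _ _)

  open Counting k s

  count-up   : ∀ n r → Bounded r → Seq AltUp   n r ↔ Fin (upCount   n r)
  count-down : ∀ n r → Bounded r → Seq AltDown n r ↔ Fin (downCount n r)

  count-up zero          r br = ¬⇒↔Fin0 (Seq-empty {AltUp})
  count-up (suc zero)    r br = Seq-single AltUp (λ _ → tt) (λ _ _ _ → refl) r br
  count-up (suc (suc n)) r br@(1≤r , r≤k) =
    ↔-trans (Seq-up-step n r br) (Σℕ↔Fin-sumℕFrom _ (downCount (suc n)) r (suc k ∸ r)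
      (λ d d< → count-down (suc n) (r + d) (ℕ.≤-trans 1≤r (ℕ.m≤m+n r d) , <∸⇒+≤ r≤k d<))
      (λ { d le ((_ ∷ _) , ((_ , b≤k) ∷ _) , b≡r+d , _) →
             ℕ.<⇒≱ (+≤⇒<∸ r≤k (subst (_≤ k) (just-injective b≡r+d) b≤k)) le }))

  count-down zero          r br = ¬⇒↔Fin0 (Seq-empty {AltDown})
  count-down (suc zero)    r br = Seq-single AltDown (λ _ → tt) (λ _ _ _ → refl) r br
  count-down (suc (suc n)) r br@(_ , r≤k) =
    ↔-trans (Seq-down-step n r br) (Σℕ↔Fin-sumℕFrom _ (upCount (suc n)) 1 r
      (λ d d<r → ↔-trans (×-contractˡ d<r ℕ.≤-irrelevant)
                         (count-up (suc n) (suc d) (s≤s z≤n , ℕ.≤-trans d<r r≤k)))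
      (λ d r≤d (d<r , _) → ℕ.<⇒≱ d<r r≤d))

count≡upCount : ∀ k s r → 1 ≤ r → r ≤ k → (a : ℕ → ℕ) → (∀ n → 𝒜 n k r s ↔ Fin (a n)) →
  ∀ n → a n ≡ Counting.upCount k s n r
count≡upCount k s r 1≤r r≤k a count n =
  ↔⇒≡ (↔-trans (↔-sym (count n)) (Sequences.count-up k s n r (1≤r , r≤k)))

sumℕFrom-coeff : ∀ m i l (h : ℕ → ℕ) (Z : ℕ → Series) → (∀ b → Z b m ≡ + h (suc b)) →
  + sumℕFrom (suc i) l h ≡ sumFrom i l Z m
sumℕFrom-coeff m i zero    h Z Z≡h = refl
sumℕFrom-coeff m i (suc l) h Z Z≡h =
  trans (ℤ.pos-+ (h (suc i)) _) (cong₂ _+ℤ_ (sym (Z≡h i)) (sumℕFrom-coeff m (suc i) l h Z Z≡h))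

constant-term-and-shift : ∀ {f} c S → f 0 ≡ c → (∀ m → f (suc m) ≡ S m) → f ≈ˢ const c +ˢ X *ˢ S
constant-term-and-shift c S f0≡c f′≡S = ≈ˢ-trans
  (coeffwise λ { zero    → trans f0≡c (sym (ℤ.+-identityʳ c))
               ; (suc m) → trans (f′≡S m) (sym (ℤ.+-identityˡ (S m))) })
  (+ˢ-congˡ (const c) (X*≈X*ˢ S))

module CountingSeries (K j : ℕ) where
  open Counting (suc K) (suc j)

  A B : ℕ → Series
  A i m = + upCount   (suc m) (suc i)
  B i m = + downCount (suc m) (suc i)

  isTransferSolution : IsTransferSolution K (λ i → const (+ δ i j)) A B
  isTransferSolution = record
    { up   = λ i _ → constant-term-and-shift (+ δ i j) _ refl λ m →
               sumℕFrom-coeff m i (suc K ∸ i) (downCount (suc m)) B λ _ → refl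
    ; down = λ i _ → constant-term-and-shift (+ δ i j) _ refl λ m →
               sumℕFrom-coeff m 0 (suc i) (upCount (suc m)) A λ _ → refl }

generatingFunction : ∀ K j i → j ≤ K → i ≤ K →
  CountingSeries.A K j i *ˢ ExplicitSolution.D K j ≈ˢ ExplicitSolution.P K j i
generatingFunction K j i j≤K i≤K = coeffwise λ m →
  proj₁ (transferSolution-unique (transferSolution-*ˢ (CountingSeries.isTransferSolution K j) D)
                                 (isTransferSolution j≤K) m i i≤K)
  where open ExplicitSolution K j

-- Even and odd parts

odd? : ℕ → Bool
odd? zero    = false
odd? (suc n) = not (odd? n)

odd?-double : ∀ n → odd? (double n) ≡ false
odd?-double zero    = refl
odd?-double (suc n) = trans (not-involutive (odd? (double n))) (odd?-double n)

onParity : Bool → Bool → ℤ → ℤ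
onParity true  true  z = z
onParity false false z = z
onParity true  false z = + 0
onParity false true  z = + 0

restrict : Bool → Series → Series
restrict b f m = onParity (odd? m) b (f m)

HasParity : Bool → Series → Set
HasParity b f = f ≋ restrict b f

onParity-not : ∀ p b z → onParity (not p) b z ≡ onParity p (not b) z
onParity-not true  true  z = refl
onParity-not true  false z = refl
onParity-not false true  z = refl
onParity-not false false z = refl

onParity-idem : ∀ p b z → onParity p b (onParity p b z) ≡ onParity p b z
onParity-idem true  true  z = refl
onParity-idem false false z = refl
onParity-idem true  false z = refl
onParity-idem false true  z = refl

onParity-+ : ∀ p b u v → onParity p b (u +ℤ v) ≡ onParity p b u +ℤ onParity p b v
onParity-+ true  true  u v = refl
onParity-+ false false u v = refl
onParity-+ true  false u v = refl
onParity-+ false true  u v = refl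

onParity-neg : ∀ p b u → onParity p b (- u) ≡ - onParity p b u
onParity-neg true  true  u = refl
onParity-neg false false u = refl
onParity-neg true  false u = refl
onParity-neg false true  u = refl

onParity-opposite : ∀ p b z → onParity p b (onParity p (not b) z) ≡ + 0
onParity-opposite true  true  z = refl
onParity-opposite false false z = refl
onParity-opposite true  false z = refl
onParity-opposite false true  z = refl

-- The coefficient of x^(m+1) in restrict b f *ˢ g, as f₀ g_{m+1} plus the rest.
onParity-*-step : ∀ p b c f₀ y z → y ≡ onParity (not p) c y →
  onParity false b f₀ *ℤ y +ℤ onParity p (c xor not b) z ≡ onParity (not p) (c xor b) (f₀ *ℤ y +ℤ z)
onParity-*-step false false false f₀ y z y≡ rewrite y≡ = trans (ℤ.+-identityʳ _) (ℤ.*-zeroʳ f₀)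
onParity-*-step false false true  f₀ y z y≡ = refl
onParity-*-step false true  false f₀ y z y≡ rewrite y≡ = cong (_+ℤ z) (sym (ℤ.*-zeroʳ f₀))
onParity-*-step false true  true  f₀ y z y≡ = trans (ℤ.+-identityʳ _) (ℤ.*-zeroˡ y)
onParity-*-step true  false false f₀ y z y≡ = refl
onParity-*-step true  false true  f₀ y z y≡ rewrite y≡ = trans (ℤ.+-identityʳ _) (ℤ.*-zeroʳ f₀)
onParity-*-step true  true  false f₀ y z y≡ = trans (ℤ.+-identityʳ _) (ℤ.*-zeroˡ y)
onParity-*-step true  true  true  f₀ y z y≡ rewrite y≡ = cong (_+ℤ z) (sym (ℤ.*-zeroʳ f₀))

restrict-*ˢ : ∀ {c g} → HasParity c g → ∀ b f → (restrict b f *ˢ g) ≋ restrict (c xor b) (f *ˢ g)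
restrict-*ˢ {false} g-even false f zero = refl
restrict-*ˢ {true}  g-odd  false f zero = trans (cong (f 0 *ℤ_) (g-odd 0)) (ℤ.*-zeroʳ (f 0))
restrict-*ˢ {false} {g} g-even true f zero = ℤ.*-zeroˡ (g 0)
restrict-*ˢ {true}  {g} g-odd  true f zero =
  trans (ℤ.*-zeroˡ (g 0)) (sym (trans (cong (f 0 *ℤ_) (g-odd 0)) (ℤ.*-zeroʳ (f 0))))
restrict-*ˢ {c} {g} g-par b f (suc m) =
  trans (cong (onParity false b (f 0) *ℤ g (suc m) +ℤ_)
          (trans (*ˢ-cong (λ n → onParity-not (odd? n) b (f (suc n))) ≋-refl m)
                 (restrict-*ˢ g-par (not b) (tail f) m)))
        (onParity-*-step (odd? m) b c (f 0) (g (suc m)) ((tail f *ˢ g) m) (g-par (suc m)))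

HasParity-*ˢ : ∀ {b c f g} → HasParity b f → HasParity c g → HasParity (c xor b) (f *ˢ g)
HasParity-*ˢ {b} {c} {f} {g} f-par g-par m =
  trans (restricted m)
        (sym (trans (cong (onParity (odd? m) (c xor b)) (restricted m)) (onParity-idem (odd? m) (c xor b) _)))
  where
  restricted : (f *ˢ g) ≋ restrict (c xor b) (f *ˢ g)
  restricted = ≋-trans (*ˢ-cong f-par ≋-refl) (restrict-*ˢ g-par b f)

HasParity-+ˢ : ∀ {b f g} → HasParity b f → HasParity b g → HasParity b (f +ˢ g)
HasParity-+ˢ {b} {f} {g} f-par g-par m =
  trans (cong₂ _+ℤ_ (f-par m) (g-par m)) (sym (onParity-+ (odd? m) b (f m) (g m)))

HasParity--ˢ : ∀ {b f} → HasParity b f → HasParity b (-ˢ f)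
HasParity--ˢ {b} {f} f-par m = trans (cong -_ (f-par m)) (sym (onParity-neg (odd? m) b (f m)))

onParity-0 : ∀ p b → onParity p b (+ 0) ≡ + 0
onParity-0 true  true  = refl
onParity-0 false false = refl
onParity-0 true  false = refl
onParity-0 false true  = refl

HasParity-const : ∀ c → HasParity false (const c)
HasParity-const c zero    = refl
HasParity-const c (suc m) = sym (onParity-0 (odd? (suc m)) false)

HasParity-X* : ∀ {b f} → HasParity b f → HasParity (not b) (X* f)
HasParity-X* {false} f-par zero = refl
HasParity-X* {true}  f-par zero = refl
HasParity-X* {b} {f} f-par (suc m) =
  trans (f-par m) (trans (cong (λ c → onParity (odd? m) c (f m)) (sym (not-involutive b)))
                         (sym (onParity-not (odd? m) (not b) (f m))))

HasParity-Uhalf : ∀ n → HasParity (odd? n) (Uhalf n)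
HasParity-Uhalf zero          = λ { zero → refl ; (suc m) → sym (onParity-0 (odd? (suc m)) false) }
HasParity-Uhalf (suc zero)    = HasParity-X* (HasParity-Uhalf 0)
HasParity-Uhalf (suc (suc n)) = HasParity-+ˢ (HasParity-X* (HasParity-Uhalf (suc n)))
  (HasParity--ˢ (subst (λ b → HasParity b (Uhalf n)) (sym (not-involutive (odd? n))) (HasParity-Uhalf n)))

HasParity-Ueven : ∀ n → HasParity false (Ueven n)
HasParity-Ueven n = subst (λ b → HasParity b (Ueven n)) (odd?-double n) (HasParity-Uhalf (double n))

HasParity-Uodd : ∀ n → HasParity true (Uodd n)
HasParity-Uodd n = subst (λ b → HasParity b (Uodd n)) (cong not (odd?-double n)) (HasParity-Uhalf (suc (double n)))

HasParity-monomial : ∀ {b c e f g} → HasParity false e → HasParity b f → HasParity c g →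
  HasParity ((c xor b) xor true) (e *ˢ X *ˢ (f *ˢ g))
HasParity-monomial e-even f-par g-par =
  HasParity-*ˢ (HasParity-*ˢ e-even (HasParity-Uhalf 1)) (HasParity-*ˢ f-par g-par)

restrict-+ˢ-opposite : ∀ b {f g} → HasParity b f → HasParity (not b) g → restrict b (f +ˢ g) ≋ f
restrict-+ˢ-opposite b {f} {g} f-par g-par m =
  trans (onParity-+ (odd? m) b (f m) (g m))
        (trans (cong₂ _+ℤ_ (sym (f-par m))
                           (trans (cong (onParity (odd? m) b) (g-par m)) (onParity-opposite (odd? m) b (g m))))
               (ℤ.+-identityʳ (f m)))

gfOdd-restrict : ∀ a → gfOdd a ≋ restrict false (λ m → + a (suc m))
gfOdd-restrict a zero          = refl
gfOdd-restrict a (suc zero)    = refl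
gfOdd-restrict a (suc (suc m)) =
  trans (gfOdd-restrict (λ n → a (suc (suc n))) m)
        (cong (λ p → onParity p false (+ a (suc (suc (suc m))))) (sym (not-involutive (odd? m))))

gfEven-restrict : ∀ a → gfEven a ≋ restrict true (λ m → + a (suc m))
gfEven-restrict a zero    = refl
gfEven-restrict a (suc m) =
  trans (gfOdd-restrict (λ n → a (suc n)) m) (sym (onParity-not (odd? m) true (+ a (suc (suc m)))))

restrict-generatingFunction : ∀ (a : ℕ → ℕ) b {D f g} → HasParity false D → HasParity b f →
  HasParity (not b) g → (λ m → + a (suc m)) *ˢ D ≈ˢ f +ˢ g → (restrict b (λ m → + a (suc m)) *ˢ D) ≋ f
restrict-generatingFunction a b {D} D-even f-par g-par AD≈ =
  ≋-trans (restrict-*ˢ D-even b (λ m → + a (suc m)))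
          (≋-trans (λ m → cong (onParity (odd? m) b) (coeff AD≈ m)) (restrict-+ˢ-opposite b f-par g-par))

parity-split : ∀ (a : ℕ → ℕ) {D f g} → HasParity false D → HasParity false f → HasParity true g →
  (λ m → + a (suc m)) *ˢ D ≈ˢ f +ˢ g → ((gfOdd a ⊛ D) ≋ f) × ((gfEven a ⊛ D) ≋ g)
parity-split a {D} {f} {g} D-even f-even g-odd AD≈ =
    ≋-trans (⊛≋*ˢ (gfOdd a) D) (≋-trans (*ˢ-cong (gfOdd-restrict a) ≋-refl)
      (restrict-generatingFunction a false D-even f-even g-odd AD≈))
  , ≋-trans (⊛≋*ˢ (gfEven a) D) (≋-trans (*ˢ-cong (gfEven-restrict a) ≋-refl)
      (restrict-generatingFunction a true D-even g-odd f-even (≈ˢ-trans AD≈ (+-comm f g))))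

2*≡double : ∀ n → 2 * n ≡ double n
2*≡double zero    = refl
2*≡double (suc n) = cong suc (trans (ℕ.+-suc n (n + 0)) (cong suc (2*≡double n)))

double-∸ : ∀ a b → double a ∸ double b ≡ double (a ∸ b)
double-∸ a       zero    = refl
double-∸ zero    (suc b) = refl
double-∸ (suc a) (suc b) = double-∸ a b

double+1∸double : ∀ a b → b ≤ a → double a + 1 ∸ double b ≡ suc (double (a ∸ b))
double+1∸double a       zero    _         = ℕ.+-comm (double a) 1
double+1∸double (suc a) (suc b) (s≤s b≤a) = double+1∸double a b b≤a

Uhalf-2k : ∀ K → Uhalf (2 * suc K) ≡ Ueven (suc K)
Uhalf-2k K = cong Uhalf (2*≡double (suc K))

Uhalf-2r∸2 : ∀ r → Uhalf (2 * suc r ∸ 2) ≡ Ueven r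
Uhalf-2r∸2 r = cong (λ n → Uhalf (n ∸ 2)) (2*≡double (suc r))

Uhalf-2r∸1 : ∀ r → Uhalf (2 * suc r ∸ 1) ≡ Uodd r
Uhalf-2r∸1 r = cong (λ n → Uhalf (n ∸ 1)) (2*≡double (suc r))

Uhalf-2k+1∸2r : ∀ {K r} → r ≤ K → Uhalf (2 * suc K + 1 ∸ 2 * suc r) ≡ Uodd (K ∸ r)
Uhalf-2k+1∸2r {K} {r} r≤K =
  cong Uhalf (trans (cong₂ (λ m n → m + 1 ∸ n) (2*≡double (suc K)) (2*≡double (suc r)))
                    (double+1∸double K r r≤K))

2k∸2r≡double : ∀ K r → 2 * suc K ∸ 2 * suc r ≡ double (K ∸ r)
2k∸2r≡double K r = trans (cong₂ _∸_ (2*≡double (suc K)) (2*≡double (suc r))) (double-∸ K r)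

Uhalf-2k∸2r : ∀ K r → Uhalf (2 * suc K ∸ 2 * suc r) ≡ Ueven (K ∸ r)
Uhalf-2k∸2r K r = cong Uhalf (2k∸2r≡double K r)

Uhalf-2k∸2r+1 : ∀ K r → Uhalf (2 * suc K ∸ 2 * suc r + 1) ≡ Uodd (K ∸ r)
Uhalf-2k∸2r+1 K r = cong Uhalf (trans (cong (_+ 1) (2k∸2r≡double K r)) (ℕ.+-comm _ 1))

module GeneratingFunctions (K j i : ℕ) (j≤K : j ≤ K) (i≤K : i ≤ K) (a : ℕ → ℕ)
  (a≡upCount : ∀ n → a n ≡ Counting.upCount (suc K) (suc j) n (suc i)) where
  open ExplicitSolution K j

  parts : ∀ {f g} → HasParity false f → HasParity true g → P i ≈ˢ f +ˢ g →
    ((gfOdd a ⊛ D) ≋ f) × ((gfEven a ⊛ D) ≋ g)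
  parts f-even g-odd P≈ = parity-split a (HasParity-Ueven (suc K)) f-even g-odd (begin
    (λ m → + a (suc m)) *ˢ D  ≈⟨ *ˢ-congʳ D (coeffwise λ m → cong +_ (a≡upCount (suc m))) ⟩
    CountingSeries.A K j i *ˢ D ≈⟨ generatingFunction K j i j≤K i≤K ⟩
    P i                       ≈⟨ P≈ ⟩
    _                         ∎)


  t u : ℕ
  t = K ∸ j
  u = K ∸ i

  parts-< : i < j → ((gfOdd a ⊛ D) ≋ (σ i *ˢ X *ˢ (Ueven i *ˢ Uodd t)))
                  × ((gfEven a ⊛ D) ≋ (σ i *ˢ X *ˢ (Ueven i *ˢ Ueven t)))
  parts-< i<j = parts (HasParity-monomial (HasParity-const _) (HasParity-Ueven i) (HasParity-Uodd t))
                      (HasParity-monomial (HasParity-const _) (HasParity-Ueven i) (HasParity-Ueven t)) (begin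
    P i                                   ≈⟨ P-≤ (ℕ.<⇒≤ i<j) ⟩
    F i +ˢ σ i *ˢ X *ˢ (Ueven i *ˢ G)
      ≈⟨ +ˢ-congʳ (σ i *ˢ X *ˢ (Ueven i *ˢ G)) (F-≢ λ i≡j → ℕ.<-irrefl i≡j i<j) ⟩
    const (+ 0) +ˢ σ i *ˢ X *ˢ (Ueven i *ˢ G)
      ≈⟨ solve 5 (λ s x e o q → con (+ 0) :+ s :* x :* (e :* (o :+ q)) := s :* x :* (e :* o) :+ s :* x :* (e :* q))
           ≈ˢ-refl (σ i) X (Ueven i) (Uodd t) (Ueven t) ⟩
    σ i *ˢ X *ˢ (Ueven i *ˢ Uodd t) +ˢ σ i *ˢ X *ˢ (Ueven i *ˢ Ueven t) ∎)

  parts-= : i ≡ j → ((gfOdd a ⊛ D) ≋ (D +ˢ -ˢ (X *ˢ (Ueven j *ˢ Uodd t))))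
                  × ((gfEven a ⊛ D) ≋ ((-ˢ const (+ 1)) *ˢ X *ˢ (Ueven j *ˢ Ueven t)))
  parts-= refl = parts
    (HasParity-+ˢ (HasParity-Ueven (suc K))
      (HasParity--ˢ (HasParity-*ˢ (HasParity-Uhalf 1) (HasParity-*ˢ (HasParity-Ueven j) (HasParity-Uodd t)))))
    (HasParity-monomial (HasParity--ˢ (HasParity-const (+ 1))) (HasParity-Ueven j) (HasParity-Ueven t)) (begin
    P j                                             ≈⟨ P-≤ ℕ.≤-refl ⟩
    F j +ˢ σ j *ˢ X *ˢ (Ueven j *ˢ G)
      ≈⟨ +-cong F-self (*ˢ-congʳ (Ueven j *ˢ G) (*ˢ-congʳ X σ-self)) ⟩
    D +ˢ (-ˢ const (+ 1)) *ˢ X *ˢ (Ueven j *ˢ G)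
      ≈⟨ solve 5 (λ d x e o q → d :+ (:- con (+ 1)) :* x :* (e :* (o :+ q)) :=
           (d :- x :* (e :* o)) :+ (:- con (+ 1)) :* x :* (e :* q)) ≈ˢ-refl D X (Ueven j) (Uodd t) (Ueven t) ⟩
    D +ˢ -ˢ (X *ˢ (Ueven j *ˢ Uodd t)) +ˢ (-ˢ const (+ 1)) *ˢ X *ˢ (Ueven j *ˢ Ueven t) ∎)

  parts-> : j < i → ((gfOdd a ⊛ D) ≋ (σ i *ˢ X *ˢ (Ueven j *ˢ Uodd u)))
                  × ((gfEven a ⊛ D) ≋ (σ i *ˢ X *ˢ (Uodd j *ˢ Uodd u)))
  parts-> j<i = parts (HasParity-monomial (HasParity-const _) (HasParity-Ueven j) (HasParity-Uodd u))
                      (HasParity-monomial (HasParity-const _) (HasParity-Uodd j) (HasParity-Uodd u)) (begin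
    P i                                  ≈⟨ P-> j<i ⟩
    σ i *ˢ X *ˢ ((Ueven j +ˢ Uodd j) *ˢ Uodd u)
      ≈⟨ solve 5 (λ s x e o q → s :* x :* ((e :+ o) :* q) := s :* x :* (e :* q) :+ s :* x :* (o :* q))
           ≈ˢ-refl (σ i) X (Ueven j) (Uodd j) (Uodd u) ⟩
    σ i *ˢ X *ˢ (Ueven j *ˢ Uodd u) +ˢ σ i *ˢ X *ˢ (Uodd j *ˢ Uodd u) ∎)

  private
    restate : ∀ A {B C} → (A ⊛ D) ≋ B → B ≈ˢ C → (A ⊛ Uhalf (2 * suc K)) ≋ C
    restate A p q = ≋-trans (λ m → cong (λ U → (A ⊛ U) m) (Uhalf-2k K)) (≋-trans p (coeff q))

  odd-< : suc i < suc j → (gfOdd a ⊛ Uhalf (2 * suc K))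
    ≋ (sgn (suc i + suc j + 1) · X* (Uhalf (2 * suc i ∸ 2) ⊛ Uhalf (2 * suc K + 1 ∸ 2 * suc j)))
  odd-< (s≤s i<j) = restate (gfOdd a) (proj₁ (parts-< i<j))
    (≈ˢ-sym (·X*⊛≈ (sgn-shift i j) (Uhalf-2r∸2 i) (Uhalf-2k+1∸2r j≤K)))

  odd-= : suc i ≡ suc j → (gfOdd a ⊛ Uhalf (2 * suc K))
    ≋ (Uhalf (2 * suc K) ⊖ X* (Uhalf (2 * suc i ∸ 2) ⊛ Uhalf (2 * suc K + 1 ∸ 2 * suc i)))
  odd-= refl = restate (gfOdd a) (proj₁ (parts-= refl))
    (≈ˢ-sym (+-cong (≈ˢ-reflexive (Uhalf-2k K)) (-‿cong (≈ˢ-trans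
      (≈ˢ-reflexive (cong₂ (λ f g → X* (f ⊛ g)) (Uhalf-2r∸2 i) (Uhalf-2k+1∸2r i≤K))) (X*⊛≈ _ _)))))

  odd-> : suc j < suc i → (gfOdd a ⊛ Uhalf (2 * suc K))
    ≋ (sgn (suc i + suc j + 1) · X* (Uhalf (2 * suc j ∸ 2) ⊛ Uhalf (2 * suc K + 1 ∸ 2 * suc i)))
  odd-> (s≤s j<i) = restate (gfOdd a) (proj₁ (parts-> j<i))
    (≈ˢ-sym (·X*⊛≈ (sgn-shift i j) (Uhalf-2r∸2 j) (Uhalf-2k+1∸2r i≤K)))

  even-≤ : suc i ≤ suc j → (gfEven a ⊛ Uhalf (2 * suc K))
    ≋ (sgn (suc i + suc j + 1) · X* (Uhalf (2 * suc i ∸ 2) ⊛ Uhalf (2 * suc K ∸ 2 * suc j)))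
  even-≤ (s≤s i≤j) with ℕ.m≤n⇒m<n∨m≡n i≤j
  ... | inj₁ i<j  = restate (gfEven a) (proj₂ (parts-< i<j))
    (≈ˢ-sym (·X*⊛≈ (sgn-shift i j) (Uhalf-2r∸2 i) (Uhalf-2k∸2r K j)))
  ... | inj₂ refl = restate (gfEven a) (proj₂ (parts-= refl))
    (≈ˢ-sym (≈ˢ-trans (·X*⊛≈ (sgn-shift i i) (Uhalf-2r∸2 i) (Uhalf-2k∸2r K i))
                      (*ˢ-congʳ _ (*ˢ-congʳ X σ-self))))

  even-> : suc j < suc i → (gfEven a ⊛ Uhalf (2 * suc K))
    ≋ (sgn (suc i + suc j + 1) · X* (Uhalf (2 * suc j ∸ 1) ⊛ Uhalf (2 * suc K ∸ 2 * suc i + 1)))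
  even-> (s≤s j<i) = restate (gfEven a) (proj₂ (parts-> j<i))
    (≈ˢ-sym (·X*⊛≈ (sgn-shift i j) (Uhalf-2r∸1 j) (Uhalf-2k∸2r+1 K i)))

theorem4 : (k r s : ℕ) → 1 ≤ k → 1 ≤ r → r ≤ k → 1 ≤ s → s ≤ k →
  (a : ℕ → ℕ) → (∀ n → 𝒜 n k r s ↔ Fin (a n)) →
  ((r < s →
      (gfOdd a ⊛ Uhalf (2 * k))
        ≋ (sgn (r + s + 1) · X* (Uhalf (2 * r ∸ 2) ⊛ Uhalf (2 * k + 1 ∸ 2 * s))))
   × (r ≡ s →
      (gfOdd a ⊛ Uhalf (2 * k))
        ≋ (Uhalf (2 * k) ⊖ X* (Uhalf (2 * r ∸ 2) ⊛ Uhalf (2 * k + 1 ∸ 2 * r))))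
   × (s < r →
      (gfOdd a ⊛ Uhalf (2 * k))
        ≋ (sgn (r + s + 1) · X* (Uhalf (2 * s ∸ 2) ⊛ Uhalf (2 * k + 1 ∸ 2 * r)))))
  × ((r ≤ s →
      (gfEven a ⊛ Uhalf (2 * k))
        ≋ (sgn (r + s + 1) · X* (Uhalf (2 * r ∸ 2) ⊛ Uhalf (2 * k ∸ 2 * s))))
   × (s < r →
      (gfEven a ⊛ Uhalf (2 * k))
        ≋ (sgn (r + s + 1) · X* (Uhalf (2 * s ∸ 1) ⊛ Uhalf (2 * k ∸ 2 * r + 1)))))
theorem4 (suc K) (suc i) (suc j) _ 1≤r (s≤s i≤K) _ (s≤s j≤K) a count =
  (odd-< , odd-= , odd->) , (even-≤ , even->)
  where
  open GeneratingFunctions K j i j≤K i≤K a (count≡upCount (suc K) (suc j) (suc i) 1≤r (s≤s i≤K) a count)
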